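{- Let $\mathcal{M}=(X,rk,m)$ be a multiplicity matroid whose underlying matroid $M=(X,rk)$ has no coloops, write $\mathfrak{M}_{\mathcal{M}}(x,y)=\sum_{i,j\ge0}b_{i,j}x^iy^j$, let $M^*=(X,rk^*)$ be the dual matroid, $m^*(A)=m(X\setminus A)$, and $\overline{F}=X\setminus F$. Then (1) $b_{0,|X|-rk(M)}=m(X)$; (2) $b_{0,|X|-rk(M)-1}=(s(M)-|X|+rk(M))m(X)+\sum_{F\in\mathcal{F}_1(M^*)}\sum_{A\subseteq F}(-1)^{|A|+1}m^*(A)$; (3) \[b_{0,|X|-rk(M)-2}=\Big(\tbinom{|X|-rk(M)}{2}-(|X|-rk(M)-1)s(M)+\sum_{F\in\mathcal{F}_2(M^*)}(s(M/\overline{F})-1)\Big)m(X)+\sum_{F\in\mathcal{F}_1(M^*)}(s(\overline{F})-|X|+rk(M)+1)\sum_{A\subseteq F}(-1)^{|A|+1}m^*(A)+\sum_{F\in\mathcal{F}_2(M^*)}\sum_{A\subseteq F}(-1)^{|A|}m^*(A);\] (4) $b_{1,|X|-rk(M)-1}=\sum_{F\in\mathcal{F}'_1(M^*)}\sum_{A\subseteq F,|A|\ge2}(-1)^{|A|}(|A|-1)m^*(A)$; (5) \[b_{1,|X|-rk(M)-2}=\sum_{F\in\mathcal{F}'_1(M^*)}(s(\overline{F})-|X|+rk(M)+1)\sum_{A\subseteq F,|A|\ge2}(-1)^{|A|}(|A|-1)m^*(A)+\sum_{F\in\mathcal{F}_2(M^*)}\sum_{A\subseteq F,|A|\ge2}(-1)^{|A|+1}(rk(M)-rk(X\setminus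 A))m^*(A);\] (6) \[b_{2,|X|-rk(M)-2}=\sum_{F\in\mathcal{F}'_1(M^*)}(s(\overline{F})-|X|+rk(M)+1)\sum_{A\subseteq F,|A|\ge3}(-1)^{|A|+1}\tbinom{|A|-1}{2}m^*(A)+\sum_{F\in\mathcal{F}_2(M^*)}\sum_{A\subseteq F,|A|\ge3}(-1)^{|A|}\tbinom{rk(M)-rk(X\setminus A)}{2}m^*(A).\]
   Context: A matroid $(X,rk)$ is a finite set with rank function $rk:2^X\to\mathbb{Z}_{\ge0}$ satisfying $rk(A)\le|A|$, monotonicity and submodularity; $rk(M)=rk(X)$. The dual matroid is $M^*=(X,rk^*)$ with $rk^*(A)=|A|+rk(X\setminus A)-rk(X)$. A coloop of $M$ is an element that is a loop of $M^*$ (i.e. $rk^*(\{e\})=0$). A multiplicity matroid $\mathcal{M}=(X,rk,m)$ is a matroid with an arbitrary function $m:2^X\to\mathbb{Z}_{>0}$; its multiplicity Tutte polynomial is $\mathfrak{M}_{\mathcal{M}}(x,y)=\sum_{A\subseteq X}m(A)(x-1)^{rk(X)-rk(A)}(y-1)^{|A|-rk(A)}$. A flat of a matroid is a set $F$ with $\{e: r(F\cup\{e\})=r(F)\}=F$; a circuit is a set $C$ with $r(C\setminus\{e\})=|C|-1=r(C)$ for all $e\in C$; a flat is cyclic if each of its elements lies in a circuit contained in it. $\mathcal{F}_i(M^*)$ (resp. $\mathcal{F}'_i(M^*)$) is the set of flats (resp. cyclic flats) of $M^*$ of rank $i$ in $M^*$. Elements $e,f$ are parallel if $r(\{e,f\})=r(\{e\})=r(\{f\})=1$;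 a parallel class is a maximal set of non-loop elements pairwise parallel; a series class of $N$ is a parallel class of $N^*$. $s(N)$ is the number of series classes of a matroid $N$; for $T\subseteq X$, $s(T)=s(M|T)$ where $M|T$ is the restriction to $T$, and $M/T$ is the contraction (the matroid on $X\setminus T$ with rank $rk(A\cup T)-rk(T)$). -}

module Defs where

open import Data.Nat as ℕ using (ℕ; zero; suc; _≤_; _<_; _+_; _∸_)
open import Data.Nat.Combinatorics using (_C_)
open import Data.Integer as ℤ using (ℤ; +_; -[1+_])
open import Data.Fin using (Fin)
open import Data.Fin.Subset
open import Data.Fin.Subset.Properties using (_∈?_; _⊆?_; nonempty?; anySubset?)
open import Data.Fin.Properties using (all?)
open import Data.List using (List; []; _∷_; _++_; map; filter; length)
open import Data.Vec using (_∷_; [])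
open import Data.Product using (_×_; ∃; _,_)
open import Relation.Nullary using (¬_; Dec; yes; no)
open import Relation.Nullary.Decidable using (_×-dec_; _→-dec_; ¬?; map′; decidable-stable)
open import Level using (0ℓ)
open import Relation.Unary using (Pred; Decidable)
open import Relation.Binary.PropositionalEquality using (_≡_)

record Matroid (n : ℕ) : Set where
  field
    rk      : Subset n → ℕ
    rk-card : ∀ A → rk A ≤ ∣ A ∣
    rk-mono : ∀ A B → A ⊆ B → rk A ≤ rk B
    rk-sub  : ∀ A B → rk (A ∪ B) + rk (A ∩ B) ≤ rk A + rk B

record MultMatroid (n : ℕ) : Set where
  field
    matroid : Matroid n
    m       : Subset n → ℕ
    m-pos   : ∀ A → 0 < m A
  open Matroid matroid public

allSubsets : ∀ n → List (Subset n)
allSubsets zero    = [] ∷ []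
allSubsets (suc n) = map (outside ∷_) (allSubsets n) ++ map (inside ∷_) (allSubsets n)

sumL : ∀ {A : Set} → List A → (A → ℤ) → ℤ
sumL []       f = + 0
sumL (x ∷ xs) f = f x ℤ.+ sumL xs f

sumWhere : ∀ {n} (P : Pred (Subset n) 0ℓ) → Decidable P → (Subset n → ℤ) → ℤ
sumWhere {n} P P? f = sumL (filter P? (allSubsets n)) f

countWhere : ∀ {n} (P : Pred (Subset n) 0ℓ) → Decidable P → ℕ
countWhere {n} P P? = length (filter P? (allSubsets n))

allSubset? : ∀ {n} {P : Pred (Subset n) 0ℓ} → Decidable P → Dec (∀ Q → P Q)
allSubset? P? = map′ (λ h Q → decidable-stable (P? Q) (λ ¬p → h (Q , ¬p)))
                     (λ h (Q , ¬p) → ¬p (h Q))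
                     (¬? (anySubset? (λ Q → ¬? (P? Q))))

-- A matroid "living on" a ground set E ⊆ Fin n is given by E and a rank
-- function r (only its values on subsets of E matter).

dualRk : ∀ {n} → Subset n → (Subset n → ℕ) → Subset n → ℕ
dualRk E r A = ∣ A ∣ + r (E ─ A) ∸ r E

-- contraction by T: rank  A ↦ r(A ∪ T) - r(T)  (ground set E ─ T)
contrRk : ∀ {n} → (Subset n → ℕ) → Subset n → Subset n → ℕ
contrRk r T A = r (A ∪ T) ∸ r T

Parallel : ∀ {n} → (Subset n → ℕ) → Fin n → Fin n → Set
Parallel r e f = r (⁅ e ⁆ ∪ ⁅ f ⁆) ≡ 1 × r ⁅ e ⁆ ≡ 1 × r ⁅ f ⁆ ≡ 1

PairwisePar : ∀ {n} → (Subset n → ℕ) → Subset n → Set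
PairwisePar r P = ∀ e f → e ∈ P → f ∈ P → Parallel r e f

IsParClass : ∀ {n} → Subset n → (Subset n → ℕ) → Subset n → Set
IsParClass E r P =
  P ⊆ E × Nonempty P × PairwisePar r P ×
  (∀ Q → P ⊆ Q → Q ⊆ E → PairwisePar r Q → Q ⊆ P)

parallel? : ∀ {n} (r : Subset n → ℕ) e f → Dec (Parallel r e f)
parallel? r e f = (r (⁅ e ⁆ ∪ ⁅ f ⁆) ℕ.≟ 1) ×-dec (r ⁅ e ⁆ ℕ.≟ 1) ×-dec (r ⁅ f ⁆ ℕ.≟ 1)

pairwisePar? : ∀ {n} (r : Subset n → ℕ) → Decidable (PairwisePar r)
pairwisePar? r P = all? λ e → all? λ f → (e ∈? P) →-dec (f ∈? P) →-dec parallel? r e f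

isParClass? : ∀ {n} E (r : Subset n → ℕ) → Decidable (IsParClass E r)
isParClass? E r P =
  (P ⊆? E) ×-dec nonempty? P ×-dec pairwisePar? r P ×-dec
  allSubset? (λ Q → (P ⊆? Q) →-dec (Q ⊆? E) →-dec pairwisePar? r Q →-dec (Q ⊆? P))

numParClasses : ∀ {n} → Subset n → (Subset n → ℕ) → ℕ
numParClasses E r = countWhere (IsParClass E r) (isParClass? E r)

numSeriesClasses : ∀ {n} → Subset n → (Subset n → ℕ) → ℕ
numSeriesClasses E r = numParClasses E (dualRk E r)

IsFlat : ∀ {n} → (Subset n → ℕ) → Subset n → Set
IsFlat r F = ∀ e → r (F ∪ ⁅ e ⁆) ≡ r F → e ∈ F

-- circuit: r(C \ {e}) = |C| - 1 = r(C) for all e ∈ C  (|C| - 1 read in ℤ)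
IsCircuit : ∀ {n} → (Subset n → ℕ) → Subset n → Set
IsCircuit r C = ∣ C ∣ ≡ suc (r C) × (∀ e → e ∈ C → r (C - e) ≡ r C)

IsCyclicFlat : ∀ {n} → (Subset n → ℕ) → Subset n → Set
IsCyclicFlat r F = IsFlat r F × (∀ e → e ∈ F → ∃ λ C → C ⊆ F × IsCircuit r C × e ∈ C)

isFlat? : ∀ {n} (r : Subset n → ℕ) → Decidable (IsFlat r)
isFlat? r F = all? λ e → (r (F ∪ ⁅ e ⁆) ℕ.≟ r F) →-dec (e ∈? F)

isCircuit? : ∀ {n} (r : Subset n → ℕ) → Decidable (IsCircuit r)
isCircuit? r C = (∣ C ∣ ℕ.≟ suc (r C)) ×-dec all? λ e → (e ∈? C) →-dec (r (C - e) ℕ.≟ r C)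

isCyclicFlat? : ∀ {n} (r : Subset n → ℕ) → Decidable (IsCyclicFlat r)
isCyclicFlat? r F = isFlat? r F ×-dec
  all? λ e → (e ∈? F) →-dec anySubset? (λ C → (C ⊆? F) ×-dec isCircuit? r C ×-dec (e ∈? C))

FlatOfRank : ∀ {n} → (Subset n → ℕ) → ℕ → Subset n → Set
FlatOfRank r i F = IsFlat r F × r F ≡ i

CyclicFlatOfRank : ∀ {n} → (Subset n → ℕ) → ℕ → Subset n → Set
CyclicFlatOfRank r i F = IsCyclicFlat r F × r F ≡ i

flatOfRank? : ∀ {n} (r : Subset n → ℕ) i → Decidable (FlatOfRank r i)
flatOfRank? r i F = isFlat? r F ×-dec (r F ℕ.≟ i)

cyclicFlatOfRank? : ∀ {n} (r : Subset n → ℕ) i → Decidable (CyclicFlatOfRank r i)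
cyclicFlatOfRank? r i F = isCyclicFlat? r F ×-dec (r F ℕ.≟ i)

-- Bivariate integer polynomials as coefficient functions  (i , j) ↦ [x^i y^j]

Poly : Set
Poly = ℕ → ℕ → ℤ

constP : ℤ → Poly
constP c zero zero = c
constP c _    _    = + 0

addP : Poly → Poly → Poly
addP p q i j = p i j ℤ.+ q i j

zeroP : Poly
zeroP _ _ = + 0

sumP : ∀ {A : Set} → List A → (A → Poly) → Poly
sumP []       f = zeroP
sumP (x ∷ xs) f = addP (f x) (sumP xs f)

mulXm1 : Poly → Poly
mulXm1 p zero    j = ℤ.- p zero j
mulXm1 p (suc i) j = p i j ℤ.- p (suc i) j

mulYm1 : Poly → Poly
mulYm1 p i zero    = ℤ.- p i zero
mulYm1 p i (suc j) = p i j ℤ.- p i (suc j)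

iter : ℕ → (Poly → Poly) → Poly → Poly
iter zero    g p = p
iter (suc k) g p = g (iter k g p)

monoTerm : ℕ → ℕ → ℤ → Poly
monoTerm a b c = iter a mulXm1 (iter b mulYm1 (constP c))

multTutte : ∀ {n} → MultMatroid n → Poly
multTutte {n} 𝓜 = sumP (allSubsets n) λ A →
  monoTerm (rk ⊤ ∸ rk A) (∣ A ∣ ∸ rk A) (+ m A)
  where open MultMatroid 𝓜

-- coefficient b_{i,j} with integer indices; b_{i,j} = 0 if i < 0 or j < 0
coeff : Poly → ℤ → ℤ → ℤ
coeff p (+ i) (+ j) = p i j
coeff p _     _     = + 0

sgn : ℕ → ℤ
sgn zero    = + 1
sgn (suc k) = ℤ.- sgn k

-- coloop: loop of the dual
HasNoColoops : ∀ {n} → Matroid n → Set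
HasNoColoops {n} M = ∀ (e : Fin n) → ¬ (dualRk ⊤ (Matroid.rk M) ⁅ e ⁆ ≡ 0)

module Submission where

-- Writing A = X ∖ B, the term of A in the multiplicity Tutte polynomial is
-- m*(B) (x − 1)^(|B| − rk*(B)) (y − 1)^(rk*(X) − rk*(B)), so the coefficients of y^(|X| − rk(M) − k)
-- only involve the sets B with rk*(B) ≤ k.  As M* has no loops, ∅ is the only set of rank 0, and a
-- nonempty set B of rank j ≤ 2 lies in exactly one flat of M* of rank j, its closure, which is cyclic
-- when j = 1 and |B| ≥ 2.  Expanding the sums over flats into sums over sets B therefore reduces each
-- formula to an identity between the terms of a single B.  These identities involve numbers of flats
-- of M*, which are series-class numbers because the series classes of M, M / F̄ and M | F̄ are the
-- parallel classes of M*, M* | F and M* / F, that is, the rank-1 flats of M*, those inside F, and the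
-- rank-2 flats containing F.

module Sums where
  open import Defs using (allSubsets; sumL; sumWhere; countWhere)
  open import Data.Nat using (ℕ; zero; suc; _≤_; _≤?_)
  open import Data.Integer using (ℤ; +_; _+_; _*_)
  import Data.Integer.Properties as ℤ
  open import Data.Integer.Tactic.RingSolver using (solve-∀)
  open import Data.Bool using (true; false; if_then_else_)
  open import Data.Fin.Subset using (Subset; outside; inside; ∁; _∪_; _⊆_; ∣_∣; ⊥)
  open import Data.Fin.Subset.Properties using (_⊆?_; ∉⊥)
  open import Data.List using (List; []; _∷_; _++_; map; filter; length)
  open import Data.Vec using (_∷_; []; tail)
  open import Data.Product using (_×_; _,_)
  open import Level using (0ℓ)
  open import Relation.Nullary using (¬_; Dec; does; yes; no; contradiction)
  open import Relation.Nullary.Decidable using (_×-dec_)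
  open import Relation.Unary using (Pred; Decidable)
  open import Relation.Binary.PropositionalEquality
  open import Function using (_∘_; case_of_)
  open import Algebra.Properties.CommutativeSemigroup ℤ.+-commutativeSemigroup using (interchange)

  𝟙 : ∀ {P : Set} → Dec P → ℤ
  𝟙 P? = if does P? then + 1 else + 0

  𝟙-yes : ∀ {P : Set} (P? : Dec P) → P → 𝟙 P? ≡ + 1
  𝟙-yes (yes _) _ = refl
  𝟙-yes (no ¬p) p = contradiction p ¬p

  𝟙-no : ∀ {P : Set} (P? : Dec P) → ¬ P → 𝟙 P? ≡ + 0
  𝟙-no (yes p) ¬p = contradiction p ¬p
  𝟙-no (no _) _ = refl

  𝟙-× : ∀ {P Q : Set} (P? : Dec P) (Q? : Dec Q) → 𝟙 (P? ×-dec Q?) ≡ 𝟙 P? * 𝟙 Q?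
  𝟙-× (yes _) (yes _) = refl
  𝟙-× (yes _) (no _)  = refl
  𝟙-× (no _)  (yes _) = refl
  𝟙-× (no _)  (no _)  = refl

  𝟙-cong : ∀ {P Q : Set} (P? : Dec P) (Q? : Dec Q) → (P → Q) → (Q → P) → 𝟙 P? ≡ 𝟙 Q?
  𝟙-cong (yes p) Q? to from = sym (𝟙-yes Q? (to p))
  𝟙-cong (no ¬p) Q? to from = sym (𝟙-no Q? (λ q → ¬p (from q)))

  𝟙*-cong : ∀ {P : Set} (P? : Dec P) {x y} → (P → x ≡ y) → 𝟙 P? * x ≡ 𝟙 P? * y
  𝟙*-cong (yes p) x≡y = cong (+ 1 *_) (x≡y p)
  𝟙*-cong (no _)  _   = refl

  private variable
    A B : Set

  sumL-cong : ∀ (xs : List A) {f g : A → ℤ} → (∀ x → f x ≡ g x) → sumL xs f ≡ sumL xs g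
  sumL-cong []       f≗g = refl
  sumL-cong (x ∷ xs) f≗g = cong₂ _+_ (f≗g x) (sumL-cong xs f≗g)

  sumL-++ : ∀ (xs ys : List A) f → sumL (xs ++ ys) f ≡ sumL xs f + sumL ys f
  sumL-++ []       ys f = sym (ℤ.+-identityˡ _)
  sumL-++ (x ∷ xs) ys f = trans (cong (_+_ (f x)) (sumL-++ xs ys f)) (sym (ℤ.+-assoc (f x) _ _))

  sumL-map : ∀ (g : A → B) (xs : List A) f → sumL (map g xs) f ≡ sumL xs (λ x → f (g x))
  sumL-map g []       f = refl
  sumL-map g (x ∷ xs) f = cong (_+_ (f (g x))) (sumL-map g xs f)

  sumL-+ : ∀ (xs : List A) f g → sumL xs (λ x → f x + g x) ≡ sumL xs f + sumL xs g
  sumL-+ []       f g = refl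
  sumL-+ (x ∷ xs) f g = trans (cong (_+_ (f x + g x)) (sumL-+ xs f g)) (interchange (f x) (g x) _ _)

  sumL-*ˡ : ∀ (xs : List A) a f → sumL xs (λ x → a * f x) ≡ a * sumL xs f
  sumL-*ˡ []       a f = sym (ℤ.*-zeroʳ a)
  sumL-*ˡ (x ∷ xs) a f = trans (cong (_+_ (a * f x)) (sumL-*ˡ xs a f)) (sym (ℤ.*-distribˡ-+ a (f x) _))

  sumL-zero : ∀ (xs : List A) {f} → (∀ x → f x ≡ + 0) → sumL xs f ≡ + 0
  sumL-zero []       f≗0 = refl
  sumL-zero (x ∷ xs) f≗0 = cong₂ _+_ (f≗0 x) (sumL-zero xs f≗0)

  sumL-swap : ∀ (xs : List A) (ys : List B) (f : A → B → ℤ) →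
              sumL xs (λ x → sumL ys (f x)) ≡ sumL ys (λ y → sumL xs (λ x → f x y))
  sumL-swap []       ys f = sym (sumL-zero ys (λ _ → refl))
  sumL-swap (x ∷ xs) ys f =
    trans (cong (_+_ (sumL ys (f x))) (sumL-swap xs ys f)) (sym (sumL-+ ys (f x) _))

  sumL-filter : ∀ {P : Pred A 0ℓ} (P? : Decidable P) xs f →
                sumL (filter P? xs) f ≡ sumL xs (λ x → 𝟙 (P? x) * f x)
  sumL-filter P? []       f = refl
  sumL-filter P? (x ∷ xs) f with does (P? x)
  ... | true  = cong₂ _+_ (sym (ℤ.*-identityˡ (f x))) (sumL-filter P? xs f)
  ... | false = trans (sumL-filter P? xs f) (sym (ℤ.+-identityˡ _))

  length-filter : ∀ {P : Pred A 0ℓ} (P? : Decidable P) xs →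
                  + length (filter P? xs) ≡ sumL xs (λ x → 𝟙 (P? x))
  length-filter P? []       = refl
  length-filter P? (x ∷ xs) with does (P? x)
  ... | true  = cong (_+_ (+ 1)) (length-filter P? xs)
  ... | false = trans (length-filter P? xs) (sym (ℤ.+-identityˡ _))

  ∑ : ∀ {n} → (Subset n → ℤ) → ℤ
  ∑ {n} = sumL (allSubsets n)

  module _ {n : ℕ} where

    ∑-cong : ∀ {f g : Subset n → ℤ} → (∀ A → f A ≡ g A) → ∑ f ≡ ∑ g
    ∑-cong = sumL-cong (allSubsets n)

    ∑-+ : ∀ (f g : Subset n → ℤ) → ∑ (λ A → f A + g A) ≡ ∑ f + ∑ g
    ∑-+ = sumL-+ (allSubsets n)

    ∑-*ˡ : ∀ a (f : Subset n → ℤ) → ∑ (λ A → a * f A) ≡ a * ∑ f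
    ∑-*ˡ = sumL-*ˡ (allSubsets n)

    ∑-zero : ∀ {f : Subset n → ℤ} → (∀ A → f A ≡ + 0) → ∑ f ≡ + 0
    ∑-zero = sumL-zero (allSubsets n)

    ∑-swap : ∀ (f : Subset n → Subset n → ℤ) → ∑ (λ A → ∑ (f A)) ≡ ∑ (λ B → ∑ (λ A → f A B))
    ∑-swap = sumL-swap (allSubsets n) (allSubsets n)

    sumWhere≡∑ : ∀ {P : Pred (Subset n) 0ℓ} (P? : Decidable P) f →
                 sumWhere P P? f ≡ ∑ (λ A → 𝟙 (P? A) * f A)
    sumWhere≡∑ P? = sumL-filter P? (allSubsets n)

    countWhere≡∑ : ∀ {P : Pred (Subset n) 0ℓ} (P? : Decidable P) →
                   + countWhere P P? ≡ ∑ (λ A → 𝟙 (P? A))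
    countWhere≡∑ P? = length-filter P? (allSubsets n)

  ∑-*-+ : ∀ {n} (p x : Subset n → ℤ) k → ∑ (λ F → p F * (x F + k)) ≡ ∑ (λ F → p F * x F) + k * ∑ p
  ∑-*-+ p x k = trans (∑-cong λ F → distrib (p F) (x F) k)
    (trans (∑-+ (λ F → p F * x F) (λ F → k * p F)) (cong (_+_ (∑ (λ F → p F * x F))) (∑-*ˡ k p)))
    where
    distrib : ∀ p x k → p * (x + k) ≡ p * x + k * p
    distrib = solve-∀

  ∑-split : ∀ {n} (f : Subset (suc n) → ℤ) → ∑ f ≡ ∑ (λ A → f (outside ∷ A)) + ∑ (λ A → f (inside ∷ A))
  ∑-split {n} f = trans (sumL-++ (map (outside ∷_) (allSubsets n)) _ f)
    (cong₂ _+_ (sumL-map (outside ∷_) (allSubsets n) f) (sumL-map (inside ∷_) (allSubsets n) f))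

  ∑-single : ∀ {n} (B : Subset n) {f} → (∀ A → A ≢ B → f A ≡ + 0) → ∑ f ≡ f B
  ∑-single {zero}  []            f≗0 = ℤ.+-identityʳ _
  ∑-single {suc n} (outside ∷ B) {f} f≗0 = begin
    ∑ f                                                  ≡⟨ ∑-split f ⟩
    ∑ (λ A → f (outside ∷ A)) + ∑ (λ A → f (inside ∷ A))
      ≡⟨ cong₂ _+_ (∑-single B λ A A≢B → f≗0 (outside ∷ A) (A≢B ∘ cong tail)) (∑-zero λ A → f≗0 (inside ∷ A) λ ()) ⟩
    f (outside ∷ B) + + 0                                ≡⟨ ℤ.+-identityʳ _ ⟩
    f (outside ∷ B)                                      ∎
    where open ≡-Reasoning
  ∑-single {suc n} (inside ∷ B) {f} f≗0 = begin
    ∑ f                                                  ≡⟨ ∑-split f ⟩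
    ∑ (λ A → f (outside ∷ A)) + ∑ (λ A → f (inside ∷ A))
      ≡⟨ cong₂ _+_ (∑-zero λ A → f≗0 (outside ∷ A) λ ()) (∑-single B λ A A≢B → f≗0 (inside ∷ A) (A≢B ∘ cong tail)) ⟩
    + 0 + f (inside ∷ B)                                 ≡⟨ ℤ.+-identityˡ _ ⟩
    f (inside ∷ B)                                       ∎
    where open ≡-Reasoning

  ∑-∁ : ∀ {n} (f : Subset n → ℤ) → ∑ f ≡ ∑ (λ A → f (∁ A))
  ∑-∁ {zero}  f = refl
  ∑-∁ {suc n} f = begin
    ∑ f                                                 ≡⟨ ∑-split f ⟩
    ∑ (λ A → f (outside ∷ A)) + ∑ (λ A → f (inside ∷ A)) ≡⟨ ℤ.+-comm (∑ (λ A → f (outside ∷ A))) _ ⟩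
    ∑ (λ A → f (inside ∷ A)) + ∑ (λ A → f (outside ∷ A)) ≡⟨ cong₂ _+_ (∑-∁ (λ A → f (inside ∷ A)))
                                                                     (∑-∁ (λ A → f (outside ∷ A))) ⟩
    ∑ (λ A → f (∁ (outside ∷ A))) + ∑ (λ A → f (∁ (inside ∷ A))) ≡⟨ sym (∑-split (λ A → f (∁ A))) ⟩
    ∑ (λ A → f (∁ A))                                   ∎
    where open ≡-Reasoning

  ∑-supersets : ∀ {n} (G : Subset n) (f : Subset n → ℤ) →
                ∑ (λ P → 𝟙 (P ⊆? ∁ G) * f (P ∪ G)) ≡ ∑ (λ F → 𝟙 (G ⊆? F) * f F)
  ∑-supersets {zero}  []            f = refl
  ∑-supersets {suc n} (outside ∷ G) f = begin
    ∑ (λ P → 𝟙 (P ⊆? ∁ (outside ∷ G)) * f (P ∪ (outside ∷ G)))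
      ≡⟨ ∑-split {n} _ ⟩
    ∑ (λ P → 𝟙 (P ⊆? ∁ G) * f (outside ∷ (P ∪ G))) + ∑ (λ P → 𝟙 (P ⊆? ∁ G) * f (inside ∷ (P ∪ G)))
      ≡⟨ cong₂ _+_ (∑-supersets G (λ F → f (outside ∷ F))) (∑-supersets G (λ F → f (inside ∷ F))) ⟩
    ∑ (λ F → 𝟙 (G ⊆? F) * f (outside ∷ F)) + ∑ (λ F → 𝟙 (G ⊆? F) * f (inside ∷ F))
      ≡⟨ sym (∑-split {n} _) ⟩
    ∑ (λ F → 𝟙 ((outside ∷ G) ⊆? F) * f F) ∎
    where open ≡-Reasoning
  ∑-supersets {suc n} (inside ∷ G) f = begin
    ∑ (λ P → 𝟙 (P ⊆? ∁ (inside ∷ G)) * f (P ∪ (inside ∷ G)))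
      ≡⟨ ∑-split {n} _ ⟩
    ∑ (λ P → 𝟙 (P ⊆? ∁ G) * f (inside ∷ (P ∪ G))) + ∑ {n} (λ _ → + 0)
      ≡⟨ ℤ.+-comm (∑ (λ P → 𝟙 (P ⊆? ∁ G) * f (inside ∷ (P ∪ G)))) _ ⟩
    ∑ {n} (λ _ → + 0) + ∑ (λ P → 𝟙 (P ⊆? ∁ G) * f (inside ∷ (P ∪ G)))
      ≡⟨ cong (_+_ (∑ {n} (λ _ → + 0))) (∑-supersets G (λ F → f (inside ∷ F))) ⟩
    ∑ {n} (λ _ → + 0) + ∑ (λ F → 𝟙 (G ⊆? F) * f (inside ∷ F))
      ≡⟨ sym (∑-split {n} _) ⟩
    ∑ (λ F → 𝟙 ((inside ∷ G) ⊆? F) * f F) ∎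
    where open ≡-Reasoning

  module _ {n : ℕ} {P : Pred (Subset n) 0ℓ} (P? : Decidable P) where

    weightAbove : (Subset n → ℤ) → Subset n → ℤ
    weightAbove w A = ∑ (λ F → 𝟙 (P? F) * (𝟙 (A ⊆? F) * w F))

    sumWhere-interchange : ∀ {Q : Subset n → Pred (Subset n) 0ℓ} (Q? : ∀ F → Decidable (Q F)) (w h : Subset n → ℤ) →
      sumWhere P P? (λ F → w F * sumWhere (Q F) (Q? F) h)
        ≡ ∑ (λ A → h A * ∑ (λ F → 𝟙 (P? F) * (𝟙 (Q? F A) * w F)))
    sumWhere-interchange Q? w h = begin
      sumWhere P P? (λ F → w F * sumWhere _ (Q? F) h)
        ≡⟨ sumWhere≡∑ P? _ ⟩
      ∑ (λ F → 𝟙 (P? F) * (w F * sumWhere _ (Q? F) h))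
        ≡⟨ ∑-cong expand ⟩
      ∑ (λ F → ∑ (λ A → h A * (𝟙 (P? F) * (𝟙 (Q? F A) * w F))))
        ≡⟨ ∑-swap (λ F A → h A * (𝟙 (P? F) * (𝟙 (Q? F A) * w F))) ⟩
      ∑ (λ A → ∑ (λ F → h A * (𝟙 (P? F) * (𝟙 (Q? F A) * w F))))
        ≡⟨ ∑-cong (λ A → ∑-*ˡ (h A) (λ F → 𝟙 (P? F) * (𝟙 (Q? F A) * w F))) ⟩
      ∑ (λ A → h A * ∑ (λ F → 𝟙 (P? F) * (𝟙 (Q? F A) * w F))) ∎
      where
      open ≡-Reasoning
      reassoc : ∀ p w q h → p * (w * (q * h)) ≡ h * (p * (q * w))
      reassoc = solve-∀
      expand : ∀ F → 𝟙 (P? F) * (w F * sumWhere _ (Q? F) h) ≡ ∑ (λ A → h A * (𝟙 (P? F) * (𝟙 (Q? F A) * w F)))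
      expand F = begin
        𝟙 (P? F) * (w F * sumWhere _ (Q? F) h)
          ≡⟨ cong (λ s → 𝟙 (P? F) * (w F * s)) (sumWhere≡∑ (Q? F) h) ⟩
        𝟙 (P? F) * (w F * ∑ (λ A → 𝟙 (Q? F A) * h A))
          ≡⟨ cong (λ s → 𝟙 (P? F) * s) (sym (∑-*ˡ (w F) (λ A → 𝟙 (Q? F A) * h A))) ⟩
        𝟙 (P? F) * ∑ (λ A → w F * (𝟙 (Q? F A) * h A))
          ≡⟨ sym (∑-*ˡ (𝟙 (P? F)) (λ A → w F * (𝟙 (Q? F A) * h A))) ⟩
        ∑ (λ A → 𝟙 (P? F) * (w F * (𝟙 (Q? F A) * h A)))
          ≡⟨ ∑-cong (λ A → reassoc (𝟙 (P? F)) (w F) (𝟙 (Q? F A)) (h A)) ⟩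
        ∑ (λ A → h A * (𝟙 (P? F) * (𝟙 (Q? F A) * w F))) ∎

    sumWhere-⊆ : ∀ (w h : Subset n → ℤ) →
      sumWhere P P? (λ F → w F * sumWhere (_⊆ F) (_⊆? F) h) ≡ ∑ (λ A → h A * weightAbove w A)
    sumWhere-⊆ = sumWhere-interchange (λ F A → A ⊆? F)

    sumWhere-⊆≥ : ∀ k (w h : Subset n → ℤ) →
      sumWhere P P? (λ F → w F * sumWhere (λ A → A ⊆ F × k ≤ ∣ A ∣) (λ A → (A ⊆? F) ×-dec (k ≤? ∣ A ∣)) h)
        ≡ ∑ (λ A → (𝟙 (k ≤? ∣ A ∣) * h A) * weightAbove w A)
    sumWhere-⊆≥ k w h = trans (sumWhere-interchange (λ F A → (A ⊆? F) ×-dec (k ≤? ∣ A ∣)) w h) (∑-cong factor)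
      where
      open ≡-Reasoning
      factor : ∀ A → h A * ∑ (λ F → 𝟙 (P? F) * (𝟙 ((A ⊆? F) ×-dec (k ≤? ∣ A ∣)) * w F))
                     ≡ (𝟙 (k ≤? ∣ A ∣) * h A) * weightAbove w A
      factor A = begin
        h A * ∑ (λ F → 𝟙 (P? F) * (𝟙 ((A ⊆? F) ×-dec (k ≤? ∣ A ∣)) * w F))
          ≡⟨ cong (h A *_) (∑-cong λ F → cong (λ i → 𝟙 (P? F) * (i * w F)) (𝟙-× (A ⊆? F) (k ≤? ∣ A ∣))) ⟩
        h A * ∑ (λ F → 𝟙 (P? F) * ((𝟙 (A ⊆? F) * 𝟙 (k ≤? ∣ A ∣)) * w F))
          ≡⟨ cong (h A *_) (∑-cong λ F → pull (𝟙 (P? F)) (𝟙 (A ⊆? F)) (𝟙 (k ≤? ∣ A ∣)) (w F)) ⟩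
        h A * ∑ (λ F → 𝟙 (k ≤? ∣ A ∣) * (𝟙 (P? F) * (𝟙 (A ⊆? F) * w F)))
          ≡⟨ cong (h A *_) (∑-*ˡ (𝟙 (k ≤? ∣ A ∣)) (λ F → 𝟙 (P? F) * (𝟙 (A ⊆? F) * w F))) ⟩
        h A * (𝟙 (k ≤? ∣ A ∣) * weightAbove w A)
          ≡⟨ swap (h A) (𝟙 (k ≤? ∣ A ∣)) (weightAbove w A) ⟩
        (𝟙 (k ≤? ∣ A ∣) * h A) * weightAbove w A ∎
        where
        pull : ∀ p a b w → p * ((a * b) * w) ≡ b * (p * (a * w))
        pull = solve-∀
        swap : ∀ h b W → h * (b * W) ≡ (b * h) * W
        swap = solve-∀

    weightAbove-⊥ : ∀ w → weightAbove w ⊥ ≡ ∑ (λ F → 𝟙 (P? F) * w F)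
    weightAbove-⊥ w = ∑-cong λ F → cong (𝟙 (P? F) *_)
      (trans (cong (_* w F) (𝟙-yes (⊥ ⊆? F) (λ x∈⊥ → contradiction x∈⊥ ∉⊥))) (ℤ.*-identityˡ (w F)))

    weightAbove-single : ∀ w {A B} → (∀ F → P F → A ⊆ F → F ≡ B) → P B → A ⊆ B → weightAbove w A ≡ w B
    weightAbove-single w {A} {B} unique P-B A⊆B = begin
      weightAbove w A   ≡⟨ ∑-single B (λ F F≢B → 𝟙-×-zero (P? F) (A ⊆? F) (λ (P-F , A⊆F) → F≢B (unique F P-F A⊆F))) ⟩
      𝟙 (P? B) * (𝟙 (A ⊆? B) * w B) ≡⟨ cong₂ (λ p q → p * (q * w B)) (𝟙-yes (P? B) P-B) (𝟙-yes (A ⊆? B) A⊆B) ⟩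
      + 1 * (+ 1 * w B) ≡⟨ trans (ℤ.*-identityˡ _) (ℤ.*-identityˡ _) ⟩
      w B               ∎
      where
      open ≡-Reasoning
      𝟙-×-zero : ∀ {Q R : Set} (Q? : Dec Q) (R? : Dec R) {x} → ¬ (Q × R) → 𝟙 Q? * (𝟙 R? * x) ≡ + 0
      𝟙-×-zero Q? R? {x} ¬Q×R = trans (sym (ℤ.*-assoc (𝟙 Q?) (𝟙 R?) x))
        (trans (cong (_* x) (trans (sym (𝟙-× Q? R?)) (𝟙-no (Q? ×-dec R?) ¬Q×R))) (ℤ.*-zeroˡ x))

    weightAbove-none : ∀ w {A} → (∀ F → P F → ¬ A ⊆ F) → weightAbove w A ≡ + 0
    weightAbove-none w {A} none = ∑-zero λ F → case P? F of λ where
      (yes P-F) → trans (cong (_* (𝟙 (A ⊆? F) * w F)) (𝟙-yes (P? F) P-F))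
                    (trans (ℤ.*-identityˡ _) (trans (cong (_* w F) (𝟙-no (A ⊆? F) (none F P-F))) (ℤ.*-zeroˡ (w F))))
      (no ¬P-F) → trans (cong (_* (𝟙 (A ⊆? F) * w F)) (𝟙-no (P? F) ¬P-F)) (ℤ.*-zeroˡ (𝟙 (A ⊆? F) * w F))

    sumWhere-⊆₁ : ∀ (h : Subset n → ℤ) →
      sumWhere P P? (λ F → sumWhere (_⊆ F) (_⊆? F) h) ≡ ∑ (λ A → h A * weightAbove (λ _ → + 1) A)
    sumWhere-⊆₁ h = trans (sumL-cong (filter P? (allSubsets n)) λ F → sym (ℤ.*-identityˡ _)) (sumWhere-⊆ (λ _ → + 1) h)

    sumWhere-⊆≥₁ : ∀ k (h : Subset n → ℤ) →
      sumWhere P P? (λ F → sumWhere (λ A → A ⊆ F × k ≤ ∣ A ∣) (λ A → (A ⊆? F) ×-dec (k ≤? ∣ A ∣)) h)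
        ≡ ∑ (λ A → (𝟙 (k ≤? ∣ A ∣) * h A) * weightAbove (λ _ → + 1) A)
    sumWhere-⊆≥₁ k h = trans (sumL-cong (filter P? (allSubsets n)) λ F → sym (ℤ.*-identityˡ _)) (sumWhere-⊆≥ k (λ _ → + 1) h)

module PowerCoefficients where
  open import Defs using (Poly; constP; mulXm1; mulYm1; iter; monoTerm; sumP; sumL; sgn)
  open import Data.Nat as ℕ using (ℕ; zero; suc; _∸_; _≤_; _<_; z≤n; s≤s)
  import Data.Nat.Properties as ℕ
  open import Data.Nat.Combinatorics using (_C_; nCk+nC[k+1]≡[n+1]C[k+1]; nCk≡nC[n∸k]; nCn≡1; nC1≡n; k>n⇒nCk≡0)
  open import Data.Integer using (ℤ; +_; -[1+_]; _+_; _-_; _*_; -_)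
  import Data.Integer.Properties as ℤ
  open import Data.Integer.Tactic.RingSolver using (solve-∀)
  open import Data.List using (List; []; _∷_)
  open import Data.Sum using (inj₁; inj₂)
  open import Relation.Binary.PropositionalEquality
  open import Algebra.Properties.Ring ℤ.+-*-ring using ([y-z]x≈yx-zx)

  -- [xⁱ] (x − 1)ᵃ, following the recursion of mulXm1.
  xm1PowCoeff : ℕ → ℕ → ℤ
  xm1PowCoeff zero    zero    = + 1
  xm1PowCoeff zero    (suc i) = + 0
  xm1PowCoeff (suc a) zero    = - xm1PowCoeff a 0
  xm1PowCoeff (suc a) (suc i) = xm1PowCoeff a i - xm1PowCoeff a (suc i)

  private
    δ₀ : ℕ → ℤ → ℤ
    δ₀ zero    x = x
    δ₀ (suc _) x = + 0

    iter-mulYm1 : ∀ b c i j → iter b mulYm1 (constP c) i j ≡ δ₀ i (xm1PowCoeff b j * c)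
    iter-mulYm1 zero    c zero    zero    = sym (ℤ.*-identityˡ c)
    iter-mulYm1 zero    c zero    (suc j) = refl
    iter-mulYm1 zero    c (suc i) zero    = refl
    iter-mulYm1 zero    c (suc i) (suc j) = refl
    iter-mulYm1 (suc b) c zero    zero    rewrite iter-mulYm1 b c 0 0 = ℤ.neg-distribˡ-* (xm1PowCoeff b 0) c
    iter-mulYm1 (suc b) c (suc i) zero    rewrite iter-mulYm1 b c (suc i) 0 = refl
    iter-mulYm1 (suc b) c zero    (suc j) rewrite iter-mulYm1 b c 0 j | iter-mulYm1 b c 0 (suc j) =
      sym ([y-z]x≈yx-zx c (xm1PowCoeff b j) (xm1PowCoeff b (suc j)))
    iter-mulYm1 (suc b) c (suc i) (suc j) rewrite iter-mulYm1 b c (suc i) j | iter-mulYm1 b c (suc i) (suc j) = refl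

    iter-mulXm1 : ∀ a (p : Poly) (w : ℕ → ℤ) → (∀ i j → p i j ≡ δ₀ i (w j)) →
                  ∀ i j → iter a mulXm1 p i j ≡ xm1PowCoeff a i * w j
    iter-mulXm1 zero    p w p≡ zero    j = trans (p≡ 0 j) (sym (ℤ.*-identityˡ (w j)))
    iter-mulXm1 zero    p w p≡ (suc i) j = p≡ (suc i) j
    iter-mulXm1 (suc a) p w p≡ zero    j rewrite iter-mulXm1 a p w p≡ 0 j = ℤ.neg-distribˡ-* (xm1PowCoeff a 0) (w j)
    iter-mulXm1 (suc a) p w p≡ (suc i) j rewrite iter-mulXm1 a p w p≡ i j | iter-mulXm1 a p w p≡ (suc i) j =
      sym ([y-z]x≈yx-zx (w j) (xm1PowCoeff a i) (xm1PowCoeff a (suc i)))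

  monoTerm-coeff : ∀ a b c i j → monoTerm a b c i j ≡ xm1PowCoeff a i * (xm1PowCoeff b j * c)
  monoTerm-coeff a b c = iter-mulXm1 a (iter b mulYm1 (constP c)) (λ j → xm1PowCoeff b j * c) (iter-mulYm1 b c)

  sumP-coeff : ∀ {A : Set} (xs : List A) (f : A → Poly) i j → sumP xs f i j ≡ sumL xs (λ x → f x i j)
  sumP-coeff []       f i j = refl
  sumP-coeff (x ∷ xs) f i j = cong (_+_ (f x i j)) (sumP-coeff xs f i j)

  sgn-+ : ∀ a b → sgn (a ℕ.+ b) ≡ sgn a * sgn b
  sgn-+ zero    b = sym (ℤ.*-identityˡ (sgn b))
  sgn-+ (suc a) b rewrite sgn-+ a b = ℤ.neg-distribˡ-* (sgn a) (sgn b)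

  xm1PowCoeff-> : ∀ {a j} → a < j → xm1PowCoeff a j ≡ + 0
  xm1PowCoeff-> {zero}  {suc j} _         = refl
  xm1PowCoeff-> {suc a} {suc j} (s≤s a<j)
    rewrite xm1PowCoeff-> a<j | xm1PowCoeff-> (ℕ.m<n⇒m<1+n a<j) = refl

  private
    ∸-suc : ∀ {a j} → j < a → a ∸ j ≡ suc (a ∸ suc j)
    ∸-suc j<a = ℕ.+-∸-assoc 1 j<a

  xm1PowCoeff-closed : ∀ a j → j ≤ a → xm1PowCoeff a j ≡ sgn (a ∸ j) * + (a C j)
  xm1PowCoeff-closed zero    zero    z≤n = refl
  xm1PowCoeff-closed (suc a) zero    z≤n rewrite xm1PowCoeff-closed a 0 z≤n =
    trans (cong -_ (ℤ.*-identityʳ (sgn a))) (sym (ℤ.*-identityʳ (- sgn a)))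
  xm1PowCoeff-closed (suc a) (suc j) (s≤s j≤a) with ℕ.m≤n⇒m<n∨m≡n j≤a
  ... | inj₂ refl = begin
    xm1PowCoeff j j - xm1PowCoeff j (suc j)
      ≡⟨ cong₂ _-_ (xm1PowCoeff-closed j j ℕ.≤-refl) (xm1PowCoeff-> (ℕ.n<1+n j)) ⟩
    sgn (j ∸ j) * + (j C j) - + 0
      ≡⟨ cong₂ (λ u v → sgn u * + v - + 0) (ℕ.n∸n≡0 j) (nCn≡1 j) ⟩
    + 1
      ≡⟨ cong₂ (λ u v → sgn u * + v) (sym (ℕ.n∸n≡0 j)) (sym (nCn≡1 (suc j))) ⟩
    sgn (j ∸ j) * + (suc j C suc j) ∎
    where open ≡-Reasoning
  ... | inj₁ j<a = begin
    xm1PowCoeff a j - xm1PowCoeff a (suc j)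
      ≡⟨ cong₂ _-_ (xm1PowCoeff-closed a j j≤a) (xm1PowCoeff-closed a (suc j) j<a) ⟩
    sgn (a ∸ j) * + (a C j) - sgn (a ∸ suc j) * + (a C suc j)
      ≡⟨ cong (λ t → sgn t * + (a C j) - sgn (a ∸ suc j) * + (a C suc j)) (∸-suc j<a) ⟩
    - sgn (a ∸ suc j) * + (a C j) - sgn (a ∸ suc j) * + (a C suc j)
      ≡⟨ pascal-step (sgn (a ∸ suc j)) (+ (a C j)) (+ (a C suc j)) ⟩
    - sgn (a ∸ suc j) * (+ (a C j) + + (a C suc j))
      ≡⟨ cong (λ t → - sgn (a ∸ suc j) * t) (sym (ℤ.pos-+ (a C j) (a C suc j))) ⟩
    - sgn (a ∸ suc j) * + (a C j ℕ.+ a C suc j)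
      ≡⟨ cong (λ t → - sgn (a ∸ suc j) * + t) (nCk+nC[k+1]≡[n+1]C[k+1] a j) ⟩
    - sgn (a ∸ suc j) * + (suc a C suc j)
      ≡⟨ cong (λ t → sgn t * + (suc a C suc j)) (sym (∸-suc j<a)) ⟩
    sgn (a ∸ j) * + (suc a C suc j) ∎
    where
    open ≡-Reasoning
    pascal-step : ∀ (s x y : ℤ) → - s * x - s * y ≡ - s * (x + y)
    pascal-step = solve-∀

  xm1PowCoeff-0 : ∀ a → xm1PowCoeff a 0 ≡ sgn a
  xm1PowCoeff-0 a = trans (xm1PowCoeff-closed a 0 z≤n) (ℤ.*-identityʳ (sgn a))

  xm1PowCoeff-1 : ∀ a → xm1PowCoeff a 1 ≡ - sgn a * + a
  xm1PowCoeff-1 zero    = refl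
  xm1PowCoeff-1 (suc a) = trans (xm1PowCoeff-closed (suc a) 1 (s≤s z≤n))
    (cong₂ (λ s t → s * + t) (sym (ℤ.neg-involutive (sgn a))) (nC1≡n (suc a)))

  xm1PowCoeff-2 : ∀ a → xm1PowCoeff a 2 ≡ sgn a * + (a C 2)
  xm1PowCoeff-2 zero          = refl
  xm1PowCoeff-2 (suc zero)    = refl
  xm1PowCoeff-2 (suc (suc a)) = trans (xm1PowCoeff-closed (suc (suc a)) 2 (s≤s (s≤s z≤n)))
    (cong (_* + (suc (suc a) C 2)) (sym (ℤ.neg-involutive (sgn a))))

  xm1PowCoeffℤ : ℕ → ℤ → ℤ
  xm1PowCoeffℤ a (+ j)    = xm1PowCoeff a j
  xm1PowCoeffℤ a -[1+ _ ] = + 0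

  private
    [+m]-[+n]≡+[m∸n] : ∀ {m n} → n ≤ m → + m - + n ≡ + (m ∸ n)
    [+m]-[+n]≡+[m∸n] {m} {n} n≤m = trans (ℤ.[+m]-[+n]≡m⊖n m n) (ℤ.⊖-≥ n≤m)

  xm1PowCoeffℤ-top : ∀ a d → xm1PowCoeffℤ a (+ a - + d) ≡ sgn d * + (a C d)
  xm1PowCoeffℤ-top a d with ℕ.≤-<-connex d a
  ... | inj₁ d≤a rewrite [+m]-[+n]≡+[m∸n] d≤a = begin
    xm1PowCoeff a (a ∸ d)                ≡⟨ xm1PowCoeff-closed a (a ∸ d) (ℕ.m∸n≤m a d) ⟩
    sgn (a ∸ (a ∸ d)) * + (a C (a ∸ d))  ≡⟨ cong₂ (λ u v → sgn u * + v) (ℕ.m∸[m∸n]≡n d≤a) (sym (nCk≡nC[n∸k] d≤a)) ⟩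
    sgn d * + (a C d)                    ∎
    where open ≡-Reasoning
  ... | inj₂ a<d rewrite ℤ.[+m]-[+n]≡m⊖n a d | ℤ.⊖-< a<d | ℕ.+-∸-assoc 1 a<d | k>n⇒nCk≡0 a<d =
    sym (ℤ.*-zeroʳ (sgn d))

  xm1PowCoeffℤ-shift : ∀ {c ρ k} → ρ ≤ c → ρ ≤ k →
    xm1PowCoeffℤ (c ∸ ρ) (+ c - + k) ≡ sgn (k ∸ ρ) * + ((c ∸ ρ) C (k ∸ ρ))
  xm1PowCoeffℤ-shift {c} {ρ} {k} ρ≤c ρ≤k =
    trans (cong (xm1PowCoeffℤ (c ∸ ρ)) shift) (xm1PowCoeffℤ-top (c ∸ ρ) (k ∸ ρ))
    where
    open ≡-Reasoning
    cancel : ∀ a b r → (a + r) - (b + r) ≡ a - b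
    cancel = solve-∀
    shift : + c - + k ≡ + (c ∸ ρ) - + (k ∸ ρ)
    shift = begin
      + c - + k                              ≡⟨ cong₂ (λ u v → + u - + v) (sym (ℕ.m∸n+n≡m ρ≤c)) (sym (ℕ.m∸n+n≡m ρ≤k)) ⟩
      + (c ∸ ρ ℕ.+ ρ) - + (k ∸ ρ ℕ.+ ρ)      ≡⟨ cong₂ _-_ (ℤ.pos-+ (c ∸ ρ) ρ) (ℤ.pos-+ (k ∸ ρ) ρ) ⟩
      (+ (c ∸ ρ) + + ρ) - (+ (k ∸ ρ) + + ρ)  ≡⟨ cancel (+ (c ∸ ρ)) (+ (k ∸ ρ)) (+ ρ) ⟩
      + (c ∸ ρ) - + (k ∸ ρ)                  ∎

  xm1PowCoeffℤ-shift-> : ∀ {c ρ k} → ρ ≤ c → k < ρ → xm1PowCoeffℤ (c ∸ ρ) (+ c - + k) ≡ + 0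
  xm1PowCoeffℤ-shift-> {c} {ρ} {k} ρ≤c k<ρ
    rewrite [+m]-[+n]≡+[m∸n] (ℕ.≤-trans (ℕ.<⇒≤ k<ρ) ρ≤c) = xm1PowCoeff-> (ℕ.∸-monoʳ-< k<ρ ρ≤c)

module MatroidTheory where
  open import Defs
  open import Data.Nat as ℕ using (ℕ; zero; suc; _+_; _∸_; _≤_; _<_; s≤s)
  import Data.Nat.Properties as ℕ
  open import Data.Nat.Tactic.RingSolver using (solve-∀)
  open import Function using (id; _∘_; case_of_)
  open import Data.Bool using (true; false)
  open import Data.Fin using (Fin)
  import Data.Fin.Properties as Fin
  open import Data.Fin.Subset
  open import Data.Fin.Subset.Properties
  open import Data.Vec using (_∷_; []; here; there; tabulate)
  import Data.Vec.Properties as Vec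
  open import Data.Product using (_×_; _,_; proj₁; proj₂; ∃)
  open import Data.Sum using (inj₁; inj₂; [_,_]′)
  open import Relation.Nullary using (Dec; yes; no; does; contradiction)
  open import Relation.Binary.PropositionalEquality
  import Algebra.Lattice.Properties.BooleanAlgebra as BooleanAlgebraProperties
  open import Algebra.Properties.CommutativeSemigroup ℕ.+-commutativeSemigroup using (interchange)

  private variable
    n : ℕ
    x : Fin n
    p q o : Subset n

  ∪-lub : p ⊆ o → q ⊆ o → p ∪ q ⊆ o
  ∪-lub {p = p} {q = q} p⊆o q⊆o x∈ = [ p⊆o , q⊆o ]′ (x∈p∪q⁻ p q x∈)

  ∩-glb : o ⊆ p → o ⊆ q → o ⊆ p ∩ q
  ∩-glb o⊆p o⊆q x∈ = x∈p∩q⁺ (o⊆p x∈ , o⊆q x∈)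

  ⁅⁆⊆ : x ∈ p → ⁅ x ⁆ ⊆ p
  ⁅⁆⊆ {p = p} x∈p y∈ = subst (_∈ p) (sym (x∈⁅y⁆⇒x≡y _ y∈)) x∈p

  x∈p─q⇒x∉q : ∀ (p q : Subset n) → x ∈ p ─ q → x ∉ q
  x∈p─q⇒x∉q (_ ∷ p) (true  ∷ q) ()        here
  x∈p─q⇒x∉q (_ ∷ p) (_     ∷ q) (there h) (there h′) = x∈p─q⇒x∉q p q h h′

  ⊤─p≡∁p : ∀ (p : Subset n) → ⊤ ─ p ≡ ∁ p
  ⊤─p≡∁p []          = refl
  ⊤─p≡∁p (true  ∷ p) = cong (false ∷_) (⊤─p≡∁p p)
  ⊤─p≡∁p (false ∷ p) = cong (true ∷_) (⊤─p≡∁p p)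

  ∣p∪q∣+∣p∩q∣ : ∀ (p q : Subset n) → ∣ p ∪ q ∣ + ∣ p ∩ q ∣ ≡ ∣ p ∣ + ∣ q ∣
  ∣p∪q∣+∣p∩q∣ []          []          = refl
  ∣p∪q∣+∣p∩q∣ (true  ∷ p) (true  ∷ q) = cong suc (trans (ℕ.+-suc _ _) (trans (cong suc (∣p∪q∣+∣p∩q∣ p q)) (sym (ℕ.+-suc _ _))))
  ∣p∪q∣+∣p∩q∣ (true  ∷ p) (false ∷ q) = cong suc (∣p∪q∣+∣p∩q∣ p q)
  ∣p∪q∣+∣p∩q∣ (false ∷ p) (true  ∷ q) = trans (cong suc (∣p∪q∣+∣p∩q∣ p q)) (sym (ℕ.+-suc _ _))
  ∣p∪q∣+∣p∩q∣ (false ∷ p) (false ∷ q) = ∣p∪q∣+∣p∩q∣ p q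

  ∣p∪q∣≡∣p∣+∣q∣ : ∀ (p q : Subset n) → p ∩ q ≡ ⊥ → ∣ p ∪ q ∣ ≡ ∣ p ∣ + ∣ q ∣
  ∣p∪q∣≡∣p∣+∣q∣ {n} p q p∩q≡⊥ = begin
    ∣ p ∪ q ∣             ≡⟨ sym (ℕ.+-identityʳ _) ⟩
    ∣ p ∪ q ∣ + 0         ≡⟨ cong (∣ p ∪ q ∣ +_) (sym (trans (cong ∣_∣ p∩q≡⊥) (∣⊥∣≡0 n))) ⟩
    ∣ p ∪ q ∣ + ∣ p ∩ q ∣ ≡⟨ ∣p∪q∣+∣p∩q∣ p q ⟩
    ∣ p ∣ + ∣ q ∣         ∎
    where open ≡-Reasoning

  ∣p∣+∣q─p∣ : ∀ (p q : Subset n) → p ⊆ q → ∣ p ∣ + ∣ q ─ p ∣ ≡ ∣ q ∣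
  ∣p∣+∣q─p∣ []          []          _   = refl
  ∣p∣+∣q─p∣ (true  ∷ p) (true  ∷ q) p⊆q = cong suc (∣p∣+∣q─p∣ p q (drop-∷-⊆ p⊆q))
  ∣p∣+∣q─p∣ (true  ∷ p) (false ∷ q) p⊆q with () ← p⊆q here
  ∣p∣+∣q─p∣ (false ∷ p) (true  ∷ q) p⊆q = trans (ℕ.+-suc _ _) (cong suc (∣p∣+∣q─p∣ p q (drop-∷-⊆ p⊆q)))
  ∣p∣+∣q─p∣ (false ∷ p) (false ∷ q) p⊆q = ∣p∣+∣q─p∣ p q (drop-∷-⊆ p⊆q)

  ∣p∣+∣∁p∣≡n : ∀ (p : Subset n) → ∣ p ∣ + ∣ ∁ p ∣ ≡ n
  ∣p∣+∣∁p∣≡n p = trans (cong (∣ p ∣ +_) (∣∁p∣≡n∸∣p∣ p)) (ℕ.m+[n∸m]≡n (∣p∣≤n p))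

  module Closure {n : ℕ} (M : Matroid n) where
    open Matroid M

    rk-⊥ : rk ⊥ ≡ 0
    rk-⊥ = ℕ.n≤0⇒n≡0 (ℕ.≤-trans (rk-card ⊥) (ℕ.≤-reflexive (∣⊥∣≡0 n)))

    rk-∪-≤ : ∀ A B → rk (A ∪ B) ≤ rk A + rk B
    rk-∪-≤ A B = ℕ.≤-trans (ℕ.m≤m+n _ _) (rk-sub A B)

    rk-∪⁅⁆-≤ : ∀ S e → rk (S ∪ ⁅ e ⁆) ≤ suc (rk S)
    rk-∪⁅⁆-≤ S e = ℕ.≤-trans (rk-∪-≤ S ⁅ e ⁆) (ℕ.≤-trans (ℕ.+-monoʳ-≤ (rk S) rk⁅e⁆≤1) (ℕ.≤-reflexive (ℕ.+-comm (rk S) 1)))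
      where
      rk⁅e⁆≤1 : rk ⁅ e ⁆ ≤ 1
      rk⁅e⁆≤1 = ℕ.≤-trans (rk-card ⁅ e ⁆) (ℕ.≤-reflexive (∣⁅x⁆∣≡1 e))

    spans-mono : ∀ {S T e} → S ⊆ T → rk (S ∪ ⁅ e ⁆) ≡ rk S → rk (T ∪ ⁅ e ⁆) ≡ rk T
    spans-mono {S} {T} {e} S⊆T S-spans = ℕ.≤-antisym T∪e≤T (rk-mono T (T ∪ ⁅ e ⁆) (p⊆p∪q _))
      where
      Y = S ∪ ⁅ e ⁆
      sub : rk (T ∪ Y) + rk (T ∩ Y) ≤ rk T + rk S
      sub = ℕ.≤-trans (rk-sub T Y) (ℕ.≤-reflexive (cong (rk T +_) S-spans))
      T∪e≤T : rk (T ∪ ⁅ e ⁆) ≤ rk T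
      T∪e≤T = ℕ.≤-trans (rk-mono _ (T ∪ Y) (∪-lub (p⊆p∪q _) (⊆-trans (q⊆p∪q S ⁅ e ⁆) (q⊆p∪q T Y))))
                (ℕ.+-cancelʳ-≤ (rk S) _ _ (ℕ.≤-trans (ℕ.+-monoʳ-≤ _ (rk-mono S (T ∩ Y) (∩-glb S⊆T (p⊆p∪q _)))) sub))

    flat-absorbs : ∀ {F S e} → IsFlat rk F → S ⊆ F → rk (S ∪ ⁅ e ⁆) ≡ rk S → e ∈ F
    flat-absorbs F-flat S⊆F S-spans = F-flat _ (spans-mono S⊆F S-spans)

    flat-∪⁅⁆ : ∀ {G e} → IsFlat rk G → e ∉ G → rk (G ∪ ⁅ e ⁆) ≡ suc (rk G)
    flat-∪⁅⁆ {G} {e} G-flat e∉G with ℕ.m≤n⇒m<n∨m≡n (rk-mono G (G ∪ ⁅ e ⁆) (p⊆p∪q _))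
    ... | inj₂ eq = contradiction (G-flat e (sym eq)) e∉G
    ... | inj₁ lt = ℕ.≤-antisym (rk-∪⁅⁆-≤ G e) lt

    rk-∪-spanned : ∀ T S → (∀ e → e ∈ T → rk (S ∪ ⁅ e ⁆) ≡ rk S) → rk (S ∪ T) ≡ rk S
    rk-∪-spanned T S = go ∣ T ∣ T ℕ.≤-refl
      where
      go : ∀ k T → ∣ T ∣ ≤ k → (∀ e → e ∈ T → rk (S ∪ ⁅ e ⁆) ≡ rk S) → rk (S ∪ T) ≡ rk S
      go k T ∣T∣≤k T-spanned with nonempty? T
      ... | no T≢∅ = cong rk (trans (cong (S ∪_) (Empty-unique T≢∅)) (∪-identityʳ S))
      go zero    T ∣T∣≤k T-spanned | yes (e , e∈T) = contradiction (ℕ.<-≤-trans (x∈p⇒∣p-x∣<∣p∣ e∈T) ∣T∣≤k) λ ()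
      go (suc k) T ∣T∣≤k T-spanned | yes (e , e∈T) = ℕ.≤-antisym S∪T≤S (rk-mono S (S ∪ T) (p⊆p∪q _))
        where
        X = S ∪ (T - e)
        X≡S : rk X ≡ rk S
        X≡S = go k (T - e) (ℕ.≤-pred (ℕ.<-≤-trans (x∈p⇒∣p-x∣<∣p∣ e∈T) ∣T∣≤k)) (λ f f∈ → T-spanned f (p─q⊆p T ⁅ e ⁆ f∈))
        S∪T⊆X∪e : S ∪ T ⊆ X ∪ ⁅ e ⁆
        S∪T⊆X∪e {x} x∈ with x∈p∪q⁻ S T x∈ | x Fin.≟ e
        ... | inj₁ x∈S | _        = p⊆p∪q _ (p⊆p∪q _ x∈S)
        ... | inj₂ _   | yes refl = q⊆p∪q X ⁅ e ⁆ (x∈⁅x⁆ e)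
        ... | inj₂ x∈T | no x≢e   = p⊆p∪q _ (q⊆p∪q S (T - e) (x∈p∧x≢y⇒x∈p-y x∈T x≢e))
        S∪T≤S : rk (S ∪ T) ≤ rk S
        S∪T≤S = ℕ.≤-trans (rk-mono _ _ S∪T⊆X∪e)
                  (ℕ.≤-reflexive (trans (spans-mono (p⊆p∪q _) (T-spanned e e∈T)) X≡S))

    closure : Subset n → Subset n
    closure S = tabulate (λ f → does (rk (S ∪ ⁅ f ⁆) ℕ.≟ rk S))

    ∈-closure⁺ : ∀ {S f} → rk (S ∪ ⁅ f ⁆) ≡ rk S → f ∈ closure S
    ∈-closure⁺ {S} {f} spans = Vec.lookup⇒[]= f (closure S) (trans (Vec.lookup∘tabulate _ f) (does-yes (rk (S ∪ ⁅ f ⁆) ℕ.≟ rk S)))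
      where
      does-yes : (d : Dec (rk (S ∪ ⁅ f ⁆) ≡ rk S)) → does d ≡ true
      does-yes (yes _)  = refl
      does-yes (no ¬sp) = contradiction spans ¬sp

    ∈-closure⁻ : ∀ {S f} → f ∈ closure S → rk (S ∪ ⁅ f ⁆) ≡ rk S
    ∈-closure⁻ {S} {f} f∈ = from-does (rk (S ∪ ⁅ f ⁆) ℕ.≟ rk S) (trans (sym (Vec.lookup∘tabulate _ f)) (Vec.[]=⇒lookup f∈))
      where
      from-does : (d : Dec (rk (S ∪ ⁅ f ⁆) ≡ rk S)) → does d ≡ true → rk (S ∪ ⁅ f ⁆) ≡ rk S
      from-does (yes sp) _ = sp

    ⊆-closure : ∀ S → S ⊆ closure S
    ⊆-closure S x∈ = ∈-closure⁺ (cong rk (⊆-antisym (∪-lub ⊆-refl (⁅⁆⊆ x∈)) (p⊆p∪q _)))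

    rk-closure : ∀ S → rk (closure S) ≡ rk S
    rk-closure S = ℕ.≤-antisym
      (ℕ.≤-trans (rk-mono _ (S ∪ closure S) (q⊆p∪q S _)) (ℕ.≤-reflexive (rk-∪-spanned (closure S) S (λ _ → ∈-closure⁻))))
      (rk-mono S _ (⊆-closure S))

    closure-flat : ∀ S → IsFlat rk (closure S)
    closure-flat S f spans = ∈-closure⁺ (ℕ.≤-antisym S∪f≤S (rk-mono S _ (p⊆p∪q _)))
      where
      S∪f≤S : rk (S ∪ ⁅ f ⁆) ≤ rk S
      S∪f≤S = ℕ.≤-trans (rk-mono _ (closure S ∪ ⁅ f ⁆) (∪-lub (⊆-trans (⊆-closure S) (p⊆p∪q _)) (q⊆p∪q _ _)))
                (ℕ.≤-reflexive (trans spans (rk-closure S)))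

    closure-least : ∀ {S F} → IsFlat rk F → S ⊆ F → closure S ⊆ F
    closure-least F-flat S⊆F x∈ = flat-absorbs F-flat S⊆F (∈-closure⁻ x∈)

    flat≡closure : ∀ {S F} → IsFlat rk F → S ⊆ F → rk F ≡ rk S → F ≡ closure S
    flat≡closure {S} {F} F-flat S⊆F rkF≡rkS = ⊆-antisym F⊆clS (closure-least F-flat S⊆F)
      where
      F⊆clS : F ⊆ closure S
      F⊆clS f∈ = ∈-closure⁺ (ℕ.≤-antisym (ℕ.≤-trans (rk-mono _ F (∪-lub S⊆F (⁅⁆⊆ f∈))) (ℕ.≤-reflexive rkF≡rkS))
                                          (rk-mono S _ (p⊆p∪q _)))

  other-element : ∀ {A : Subset n} → 2 ≤ ∣ A ∣ → ∀ e → ∃ λ f → f ∈ A × f ≢ e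
  other-element {A = A} 2≤∣A∣ e with nonempty? (A - e)
  ... | yes (f , f∈) = f , p─q⊆p A ⁅ e ⁆ f∈ , x∉⁅y⁆⇒x≢y (x∈p─q⇒x∉q A ⁅ e ⁆ f∈)
  ... | no A-e≡∅ = contradiction (ℕ.≤-trans 2≤∣A∣ (ℕ.≤-trans (p⊆q⇒∣p∣≤∣q∣ A⊆⁅e⁆) (ℕ.≤-reflexive (∣⁅x⁆∣≡1 e))))
                                  λ { (s≤s ()) }
    where
    A⊆⁅e⁆ : A ⊆ ⁅ e ⁆
    A⊆⁅e⁆ {x} x∈A with x Fin.≟ e
    ... | yes refl = x∈⁅x⁆ e
    ... | no x≢e   = contradiction (x , x∈p∧x≢y⇒x∈p-y x∈A x≢e) A-e≡∅

  module Loopless {n : ℕ} (M : Matroid n) (rk-⁅⁆ : ∀ e → Matroid.rk M ⁅ e ⁆ ≡ 1) where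
    open Matroid M
    open Closure M

    rk-pos : ∀ {e B} → e ∈ B → 1 ≤ rk B
    rk-pos {e} {B} e∈B = ℕ.≤-trans (ℕ.≤-reflexive (sym (rk-⁅⁆ e))) (rk-mono _ B (⁅⁆⊆ e∈B))

    rk≡0⇒≡⊥ : ∀ {B} → rk B ≡ 0 → B ≡ ⊥
    rk≡0⇒≡⊥ rk≡0 = Empty-unique λ (e , e∈B) → contradiction (subst (1 ≤_) rk≡0 (rk-pos e∈B)) λ ()

    ⊥-flat : IsFlat rk ⊥
    ⊥-flat e spans = contradiction (subst (1 ≤_) (trans spans rk-⊥) (rk-pos (q⊆p∪q ⊥ ⁅ e ⁆ (x∈⁅x⁆ e)))) λ ()

    pair-circuit : ∀ {e f} → f ≢ e → rk (⁅ e ⁆ ∪ ⁅ f ⁆) ≡ 1 → IsCircuit rk (⁅ e ⁆ ∪ ⁅ f ⁆)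
    pair-circuit {e} {f} f≢e rk-C≡1 = ∣C∣≡2 , rk-C-x
      where
      C = ⁅ e ⁆ ∪ ⁅ f ⁆
      disjoint : Empty (⁅ e ⁆ ∩ ⁅ f ⁆)
      disjoint (x , x∈) = let (x≡e , x≡f) = x∈p∩q⁻ ⁅ e ⁆ ⁅ f ⁆ x∈ in f≢e (trans (sym (x∈⁅y⁆⇒x≡y f x≡f)) (x∈⁅y⁆⇒x≡y e x≡e))
      ∣C∣≡2 : ∣ C ∣ ≡ suc (rk C)
      ∣C∣≡2 = begin
        ∣ C ∣                 ≡⟨ ∣p∪q∣≡∣p∣+∣q∣ ⁅ e ⁆ ⁅ f ⁆ (Empty-unique disjoint) ⟩
        ∣ ⁅ e ⁆ ∣ + ∣ ⁅ f ⁆ ∣ ≡⟨ cong₂ _+_ (∣⁅x⁆∣≡1 e) (∣⁅x⁆∣≡1 f) ⟩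
        2                     ≡⟨ cong suc (sym rk-C≡1) ⟩
        suc (rk C)            ∎
        where open ≡-Reasoning
      rk-C-x : ∀ x → x ∈ C → rk (C - x) ≡ rk C
      rk-C-x x _ = ℕ.≤-antisym (rk-mono _ C (p─q⊆p C ⁅ x ⁆)) (ℕ.≤-trans (ℕ.≤-reflexive rk-C≡1) (rk-pos (proj₂ remaining)))
        where
        remaining : ∃ λ y → y ∈ C - x
        remaining with x Fin.≟ e
        ... | yes refl = f , x∈p∧x≢y⇒x∈p-y (q⊆p∪q ⁅ e ⁆ ⁅ f ⁆ (x∈⁅x⁆ f)) f≢e
        ... | no x≢e   = e , x∈p∧x≢y⇒x∈p-y (p⊆p∪q ⁅ f ⁆ (x∈⁅x⁆ e)) (x≢e ∘ sym)

    closure-cyclic : ∀ {A} → rk A ≡ 1 → 2 ≤ ∣ A ∣ → IsCyclicFlat rk (closure A)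
    closure-cyclic {A} rk-A≡1 2≤∣A∣ = closure-flat A , circuit-through
      where
      circuit-through : ∀ e → e ∈ closure A → ∃ λ C → C ⊆ closure A × IsCircuit rk C × e ∈ C
      circuit-through e e∈ with other-element 2≤∣A∣ e
      ... | f , f∈A , f≢e = ⁅ e ⁆ ∪ ⁅ f ⁆ , C⊆ , pair-circuit f≢e rk-C≡1 , p⊆p∪q ⁅ f ⁆ (x∈⁅x⁆ e)
        where
        C⊆ : ⁅ e ⁆ ∪ ⁅ f ⁆ ⊆ closure A
        C⊆ = ∪-lub (⁅⁆⊆ e∈) (⁅⁆⊆ (⊆-closure A f∈A))
        rk-C≡1 : rk (⁅ e ⁆ ∪ ⁅ f ⁆) ≡ 1
        rk-C≡1 = ℕ.≤-antisym (ℕ.≤-trans (rk-mono _ _ C⊆) (ℕ.≤-reflexive (trans (rk-closure A) rk-A≡1)))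
                             (rk-pos (p⊆p∪q ⁅ f ⁆ (x∈⁅x⁆ e)))

    -- r′ is the rank function of (M / G) | E; its parallel classes are the sets P ⊆ E
    -- for which P ∪ G is a flat covering G.
    module ParallelClassesOfContraction
      {G E : Subset n} {k : ℕ} (G-flat : IsFlat rk G) (rk-G : rk G ≡ k)
      (E∩G≡∅ : ∀ {x} → x ∈ E → x ∉ G) (E∪G-flat : IsFlat rk (E ∪ G))
      (r′ : Subset n → ℕ) (r′≡ : ∀ A → A ⊆ E → r′ A ≡ rk (A ∪ G) ∸ k) where

      rk-G∪⁅⁆ : ∀ {e} → e ∈ E → rk (G ∪ ⁅ e ⁆) ≡ suc k
      rk-G∪⁅⁆ e∈E = trans (flat-∪⁅⁆ G-flat (E∩G≡∅ e∈E)) (cong suc rk-G)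

      parallel⁺ : ∀ {e f H} → e ∈ E → f ∈ E → (⁅ e ⁆ ∪ ⁅ f ⁆) ∪ G ⊆ H → rk H ≡ suc k → Parallel r′ e f
      parallel⁺ {e} {f} e∈E f∈E ⊆H rk-H =
        r′≡1 (∪-lub (⁅⁆⊆ e∈E) (⁅⁆⊆ f∈E)) rk-e∪f∪G , r′≡1 (⁅⁆⊆ e∈E) (rk-⁅⁆∪G e∈E) , r′≡1 (⁅⁆⊆ f∈E) (rk-⁅⁆∪G f∈E)
        where
        r′≡1 : ∀ {A} → A ⊆ E → rk (A ∪ G) ≡ suc k → r′ A ≡ 1
        r′≡1 {A} A⊆E rk≡ = trans (r′≡ A A⊆E) (trans (cong (_∸ k) rk≡) (ℕ.m+n∸n≡m 1 k))
        rk-⁅⁆∪G : ∀ {x} → x ∈ E → rk (⁅ x ⁆ ∪ G) ≡ suc k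
        rk-⁅⁆∪G {x} x∈E = trans (cong rk (∪-comm ⁅ x ⁆ G)) (rk-G∪⁅⁆ x∈E)
        rk-e∪f∪G : rk ((⁅ e ⁆ ∪ ⁅ f ⁆) ∪ G) ≡ suc k
        rk-e∪f∪G = ℕ.≤-antisym (ℕ.≤-trans (rk-mono _ _ ⊆H) (ℕ.≤-reflexive rk-H))
          (ℕ.≤-trans (ℕ.≤-reflexive (sym (rk-⁅⁆∪G e∈E))) (rk-mono _ _ (∪-lub (⊆-trans (p⊆p∪q ⁅ f ⁆) (p⊆p∪q G)) (q⊆p∪q _ G))))

      parallel⁻ : ∀ {e f} → e ∈ E → f ∈ E → Parallel r′ e f → rk ((G ∪ ⁅ e ⁆) ∪ ⁅ f ⁆) ≡ rk (G ∪ ⁅ e ⁆)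
      parallel⁻ {e} {f} e∈E f∈E (r′-ef≡1 , _) = begin
        rk ((G ∪ ⁅ e ⁆) ∪ ⁅ f ⁆)       ≡⟨ cong rk (trans (∪-assoc G _ _) (∪-comm G _)) ⟩
        rk ((⁅ e ⁆ ∪ ⁅ f ⁆) ∪ G)       ≡⟨ sym (ℕ.m∸n+n≡m k≤) ⟩
        rk ((⁅ e ⁆ ∪ ⁅ f ⁆) ∪ G) ∸ k + k ≡⟨ cong (_+ k) (trans (sym (r′≡ _ (∪-lub (⁅⁆⊆ e∈E) (⁅⁆⊆ f∈E)))) r′-ef≡1) ⟩
        suc k                          ≡⟨ sym (rk-G∪⁅⁆ e∈E) ⟩
        rk (G ∪ ⁅ e ⁆)                 ∎
        where
        open ≡-Reasoning
        k≤ : k ≤ rk ((⁅ e ⁆ ∪ ⁅ f ⁆) ∪ G)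
        k≤ = ℕ.≤-trans (ℕ.≤-reflexive (sym rk-G)) (rk-mono G _ (q⊆p∪q _ G))

      parClass⁺ : ∀ P → P ⊆ E → FlatOfRank rk (suc k) (P ∪ G) → IsParClass E r′ P
      parClass⁺ P P⊆E (P∪G-flat , rk-P∪G) = P⊆E , P≢∅ , pairwise , maximal
        where
        P≢∅ : Nonempty P
        P≢∅ with nonempty? P
        ... | yes P≢∅ = P≢∅
        ... | no  P≡∅ = contradiction
          (trans (sym rk-P∪G) (trans (cong (λ X → rk (X ∪ G)) (Empty-unique P≡∅)) (trans (cong rk (∪-identityˡ G)) rk-G)))
          ℕ.1+n≢n
        pairwise : PairwisePar r′ P
        pairwise e f e∈P f∈P = parallel⁺ (P⊆E e∈P) (P⊆E f∈P)
          (∪-lub (⊆-trans (∪-lub (⁅⁆⊆ e∈P) (⁅⁆⊆ f∈P)) (p⊆p∪q G)) (q⊆p∪q P G)) rk-P∪G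
        maximal : ∀ Q → P ⊆ Q → Q ⊆ E → PairwisePar r′ Q → Q ⊆ P
        maximal Q P⊆Q Q⊆E Q-pairwise {q} q∈Q with P≢∅
        ... | e , e∈P = [ id , (λ q∈G → contradiction q∈G (E∩G≡∅ (Q⊆E q∈Q))) ]′ (x∈p∪q⁻ P G q∈P∪G)
          where
          q∈P∪G : q ∈ P ∪ G
          q∈P∪G = flat-absorbs P∪G-flat (∪-lub (q⊆p∪q P G) (⊆-trans (⁅⁆⊆ e∈P) (p⊆p∪q G)))
                    (parallel⁻ (P⊆E e∈P) (Q⊆E q∈Q) (Q-pairwise e q (P⊆Q e∈P) q∈Q))

      parClass⁻ : ∀ P → IsParClass E r′ P → P ⊆ E × FlatOfRank rk (suc k) (P ∪ G)
      parClass⁻ P (P⊆E , (e , e∈P) , P-pairwise , P-maximal) =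
        P⊆E , subst (FlatOfRank rk (suc k)) (sym P∪G≡H) (closure-flat (G ∪ ⁅ e ⁆) , rk-H)
        where
        e∈E = P⊆E e∈P
        H = closure (G ∪ ⁅ e ⁆)
        rk-H : rk H ≡ suc k
        rk-H = trans (rk-closure _) (rk-G∪⁅⁆ e∈E)
        G⊆H : G ⊆ H
        G⊆H = ⊆-trans (p⊆p∪q ⁅ e ⁆) (⊆-closure _)
        P∪G⊆H : P ∪ G ⊆ H
        P∪G⊆H = ∪-lub (λ x∈P → ∈-closure⁺ (parallel⁻ e∈E (P⊆E x∈P) (P-pairwise e _ e∈P x∈P))) G⊆H
        H∩E-pairwise : PairwisePar r′ (H ∩ E)
        H∩E-pairwise q₁ q₂ q₁∈ q₂∈ = parallel⁺ (proj₂ (x∈p∩q⁻ H E q₁∈)) (proj₂ (x∈p∩q⁻ H E q₂∈))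
          (∪-lub (∪-lub (⁅⁆⊆ (proj₁ (x∈p∩q⁻ H E q₁∈))) (⁅⁆⊆ (proj₁ (x∈p∩q⁻ H E q₂∈)))) G⊆H) rk-H
        H∩E⊆P : H ∩ E ⊆ P
        H∩E⊆P = P-maximal (H ∩ E) (∩-glb (⊆-trans (p⊆p∪q G) P∪G⊆H) P⊆E) (p∩q⊆q H E) H∩E-pairwise
        H⊆P∪G : H ⊆ P ∪ G
        H⊆P∪G {x} x∈H = [ (λ x∈E → p⊆p∪q G (H∩E⊆P (x∈p∩q⁺ (x∈H , x∈E)))) , q⊆p∪q P G ]′
          (x∈p∪q⁻ E G (closure-least E∪G-flat (∪-lub (q⊆p∪q E G) (⊆-trans (⁅⁆⊆ e∈E) (p⊆p∪q G))) x∈H))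
        P∪G≡H : P ∪ G ≡ H
        P∪G≡H = ⊆-antisym P∪G⊆H H⊆P∪G

  module Duality {n : ℕ} (M : Matroid n) where
    open Matroid M
    open Closure M using (rk-⊥; rk-∪-≤)
    open BooleanAlgebraProperties (∪-∩-booleanAlgebra n)
      using (deMorgan₁; deMorgan₂) renaming (¬⊤≈⊥ to ∁⊤≡⊥)

    r : ℕ
    r = rk ⊤

    rk* : Subset n → ℕ
    rk* = dualRk ⊤ rk

    rk≤r : ∀ A → rk A ≤ r
    rk≤r A = rk-mono A ⊤ ⊆⊤

    r≤n : r ≤ n
    r≤n = ℕ.≤-trans (rk-card ⊤) (ℕ.≤-reflexive (∣⊤∣≡n n))

    r≤∣A∣+rk∁A : ∀ A → r ≤ ∣ A ∣ + rk (∁ A)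
    r≤∣A∣+rk∁A A = ℕ.≤-trans (ℕ.≤-reflexive (cong rk (sym (p∪∁p≡⊤ A))))
                     (ℕ.≤-trans (rk-∪-≤ A (∁ A)) (ℕ.+-monoˡ-≤ (rk (∁ A)) (rk-card A)))

    rk*≡ : ∀ A → rk* A ≡ ∣ A ∣ + rk (∁ A) ∸ r
    rk*≡ A = cong (λ B → ∣ A ∣ + rk B ∸ r) (⊤─p≡∁p A)

    rk*+r : ∀ A → rk* A + r ≡ ∣ A ∣ + rk (∁ A)
    rk*+r A = trans (cong (_+ r) (rk*≡ A)) (ℕ.m∸n+n≡m (r≤∣A∣+rk∁A A))

    private
      rk*-≤ : ∀ {A B} → ∣ A ∣ + rk (∁ A) ≤ ∣ B ∣ + rk (∁ B) → rk* A ≤ rk* B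
      rk*-≤ {A} {B} le = ℕ.+-cancelʳ-≤ r (rk* A) (rk* B)
        (ℕ.≤-trans (ℕ.≤-reflexive (rk*+r A)) (ℕ.≤-trans le (ℕ.≤-reflexive (sym (rk*+r B)))))

    rk*-card : ∀ A → rk* A ≤ ∣ A ∣
    rk*-card A = ℕ.≤-trans (ℕ.≤-reflexive (rk*≡ A))
      (ℕ.≤-trans (ℕ.∸-monoˡ-≤ r (ℕ.+-monoʳ-≤ ∣ A ∣ (rk≤r (∁ A)))) (ℕ.≤-reflexive (ℕ.m+n∸n≡m ∣ A ∣ r)))

    rk*-mono : ∀ A B → A ⊆ B → rk* A ≤ rk* B
    rk*-mono A B A⊆B = rk*-≤ (begin
      (∣ A ∣) + rk (∁ A)                    ≤⟨ ℕ.+-monoʳ-≤ (∣ A ∣) (rk-mono _ _ ∁A⊆∁B∪B─A) ⟩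
      (∣ A ∣) + rk (∁ B ∪ (B ─ A))          ≤⟨ ℕ.+-monoʳ-≤ (∣ A ∣) (rk-∪-≤ (∁ B) (B ─ A)) ⟩
      (∣ A ∣) + (rk (∁ B) + rk (B ─ A))     ≤⟨ ℕ.+-monoʳ-≤ (∣ A ∣) (ℕ.+-monoʳ-≤ (rk (∁ B)) (rk-card (B ─ A))) ⟩
      (∣ A ∣) + (rk (∁ B) + (∣ B ─ A ∣))      ≡⟨ regroup (∣ A ∣) (rk (∁ B)) (∣ B ─ A ∣) ⟩
      ((∣ A ∣) + (∣ B ─ A ∣)) + rk (∁ B)      ≡⟨ cong (_+ rk (∁ B)) (∣p∣+∣q─p∣ A B A⊆B) ⟩
      (∣ B ∣) + rk (∁ B)                    ∎)
      where
      open ℕ.≤-Reasoning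
      regroup : ∀ a b c → a + (b + c) ≡ (a + c) + b
      regroup = solve-∀
      ∁A⊆∁B∪B─A : ∁ A ⊆ ∁ B ∪ (B ─ A)
      ∁A⊆∁B∪B─A {x} x∈ with x ∈? B
      ... | yes x∈B = q⊆p∪q (∁ B) _ (x∈p∧x∉q⇒x∈p─q x∈B (x∈∁p⇒x∉p x∈))
      ... | no  x∉B = p⊆p∪q _ (x∉p⇒x∈∁p x∉B)

    rk*-sub : ∀ A B → rk* (A ∪ B) + rk* (A ∩ B) ≤ rk* A + rk* B
    rk*-sub A B = ℕ.+-cancelʳ-≤ (r + r) _ _ (begin
      (rk* (A ∪ B) + rk* (A ∩ B)) + (r + r)
        ≡⟨ interchange (rk* (A ∪ B)) (rk* (A ∩ B)) r r ⟩
      (rk* (A ∪ B) + r) + (rk* (A ∩ B) + r)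
        ≡⟨ cong₂ _+_ (rk*+r (A ∪ B)) (rk*+r (A ∩ B)) ⟩
      ((∣ A ∪ B ∣) + rk (∁ (A ∪ B))) + ((∣ A ∩ B ∣) + rk (∁ (A ∩ B)))
        ≡⟨ cong₂ (λ X Y → ((∣ A ∪ B ∣) + rk X) + ((∣ A ∩ B ∣) + rk Y)) (deMorgan₂ A B) (deMorgan₁ A B) ⟩
      ((∣ A ∪ B ∣) + rk (∁ A ∩ ∁ B)) + ((∣ A ∩ B ∣) + rk (∁ A ∪ ∁ B))
        ≡⟨ regroup (∣ A ∪ B ∣) (rk (∁ A ∩ ∁ B)) (∣ A ∩ B ∣) (rk (∁ A ∪ ∁ B)) ⟩
      ((∣ A ∪ B ∣) + (∣ A ∩ B ∣)) + (rk (∁ A ∪ ∁ B) + rk (∁ A ∩ ∁ B))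
        ≤⟨ ℕ.+-monoʳ-≤ ((∣ A ∪ B ∣) + (∣ A ∩ B ∣)) (rk-sub (∁ A) (∁ B)) ⟩
      ((∣ A ∪ B ∣) + (∣ A ∩ B ∣)) + (rk (∁ A) + rk (∁ B))
        ≡⟨ cong (_+ (rk (∁ A) + rk (∁ B))) (∣p∪q∣+∣p∩q∣ A B) ⟩
      ((∣ A ∣) + (∣ B ∣)) + (rk (∁ A) + rk (∁ B))
        ≡⟨ interchange (∣ A ∣) (∣ B ∣) (rk (∁ A)) (rk (∁ B)) ⟩
      ((∣ A ∣) + rk (∁ A)) + ((∣ B ∣) + rk (∁ B))
        ≡⟨ cong₂ _+_ (sym (rk*+r A)) (sym (rk*+r B)) ⟩
      (rk* A + r) + (rk* B + r)
        ≡⟨ interchange (rk* A) r (rk* B) r ⟩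
      (rk* A + rk* B) + (r + r) ∎)
      where
      open ℕ.≤-Reasoning
      regroup : ∀ a b c d → (a + b) + (c + d) ≡ (a + c) + (d + b)
      regroup = solve-∀

    noColoops⇒rk*-⁅⁆ : HasNoColoops M → ∀ e → rk* ⁅ e ⁆ ≡ 1
    noColoops⇒rk*-⁅⁆ noColoops e with rk* ⁅ e ⁆ in eq | rk*-card ⁅ e ⁆
    ... | zero        | _  = contradiction eq (noColoops e)
    ... | suc zero    | _  = refl
    ... | suc (suc _) | le = contradiction (ℕ.≤-trans le (ℕ.≤-reflexive (∣⁅x⁆∣≡1 e))) λ { (s≤s ()) }

    r* : ℕ
    r* = n ∸ r

    rk*-⊤ : rk* ⊤ ≡ r*
    rk*-⊤ = trans (rk*≡ ⊤) (cong (_∸ r) (trans (cong₂ _+_ (∣⊤∣≡n n) (trans (cong rk ∁⊤≡⊥) rk-⊥)) (ℕ.+-identityʳ n)))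

    rk*≤r* : ∀ B → rk* B ≤ r*
    rk*≤r* B = ℕ.≤-trans (rk*-mono B ⊤ ⊆⊤) (ℕ.≤-reflexive rk*-⊤)

    -- |B| − rk* B, which equals r − rk (∁ B).
    nullity* : Subset n → ℕ
    nullity* B = r ∸ rk (∁ B)

    nullity*+rk* : ∀ B → nullity* B + rk* B ≡ ∣ B ∣
    nullity*+rk* B = ℕ.+-cancelʳ-≡ r _ _ (begin
      nullity* B + rk* B + r                    ≡⟨ ℕ.+-assoc (nullity* B) (rk* B) r ⟩
      nullity* B + (rk* B + r)                  ≡⟨ cong (nullity* B +_) (rk*+r B) ⟩
      (r ∸ rk (∁ B)) + ((∣ B ∣) + rk (∁ B))     ≡⟨ swap (r ∸ rk (∁ B)) (∣ B ∣) (rk (∁ B)) ⟩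
      (∣ B ∣) + ((r ∸ rk (∁ B)) + rk (∁ B))     ≡⟨ cong ((∣ B ∣) +_) (ℕ.m∸n+n≡m (rk≤r (∁ B))) ⟩
      (∣ B ∣) + r                               ∎)
      where
      open ≡-Reasoning
      swap : ∀ a b c → a + (b + c) ≡ b + (a + c)
      swap = solve-∀

    nullity-∁ : ∀ B → ∣ ∁ B ∣ ∸ rk (∁ B) ≡ r* ∸ rk* B
    nullity-∁ B = ℕ.+-cancelʳ-≡ (rk* B + r) _ _ (begin
      (∣ ∁ B ∣ ∸ rk (∁ B)) + (rk* B + r)              ≡⟨ cong ((∣ ∁ B ∣ ∸ rk (∁ B)) +_) (rk*+r B) ⟩
      (∣ ∁ B ∣ ∸ rk (∁ B)) + ((∣ B ∣) + rk (∁ B))     ≡⟨ swap (∣ ∁ B ∣ ∸ rk (∁ B)) (∣ B ∣) (rk (∁ B)) ⟩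
      (∣ B ∣) + ((∣ ∁ B ∣ ∸ rk (∁ B)) + rk (∁ B))     ≡⟨ cong ((∣ B ∣) +_) (ℕ.m∸n+n≡m (rk-card (∁ B))) ⟩
      (∣ B ∣) + (∣ ∁ B ∣)                             ≡⟨ ∣p∣+∣∁p∣≡n B ⟩
      n                                               ≡⟨ sym (ℕ.m∸n+n≡m r≤n) ⟩
      r* + r                                          ≡⟨ cong (_+ r) (sym (ℕ.m∸n+n≡m (rk*≤r* B))) ⟩
      (r* ∸ rk* B) + rk* B + r                        ≡⟨ ℕ.+-assoc (r* ∸ rk* B) (rk* B) r ⟩
      (r* ∸ rk* B) + (rk* B + r)                      ∎)
      where
      open ≡-Reasoning
      swap : ∀ a b c → a + (b + c) ≡ b + (a + c)
      swap = solve-∀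

    -- (M / ∁ F)* = M* | F
    dualRk-contraction : ∀ {F A} → A ⊆ F → dualRk F (contrRk rk (∁ F)) A ≡ rk* A
    dualRk-contraction {F} {A} A⊆F = begin
      (∣ A ∣) + (rk ((F ─ A) ∪ ∁ F) ∸ rk (∁ F)) ∸ (rk (F ∪ ∁ F) ∸ rk (∁ F))
        ≡⟨ cong₂ (λ X Y → (∣ A ∣) + (rk X ∸ rk (∁ F)) ∸ (rk Y ∸ rk (∁ F))) F─A∪∁F≡∁A (p∪∁p≡⊤ F) ⟩
      (∣ A ∣) + (rk (∁ A) ∸ rk (∁ F)) ∸ (r ∸ rk (∁ F))
        ≡⟨ cancel (∣ A ∣) (rk-mono _ _ (p⊆q⇒∁p⊇∁q A⊆F)) (rk≤r (∁ F)) ⟩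
      (∣ A ∣) + rk (∁ A) ∸ r
        ≡⟨ sym (rk*≡ A) ⟩
      rk* A ∎
      where
      open ≡-Reasoning
      cancel : ∀ a {u v w} → u ≤ v → u ≤ w → a + (v ∸ u) ∸ (w ∸ u) ≡ a + v ∸ w
      cancel a {u} {v} {w} u≤v u≤w = begin
        a + (v ∸ u) ∸ (w ∸ u) ≡⟨ cong (_∸ (w ∸ u)) (sym (ℕ.+-∸-assoc a u≤v)) ⟩
        a + v ∸ u ∸ (w ∸ u)   ≡⟨ ℕ.∸-+-assoc (a + v) u (w ∸ u) ⟩
        a + v ∸ (u + (w ∸ u)) ≡⟨ cong (a + v ∸_) (ℕ.m+[n∸m]≡n u≤w) ⟩
        a + v ∸ w             ∎
      F─A∪∁F≡∁A : (F ─ A) ∪ ∁ F ≡ ∁ A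
      F─A∪∁F≡∁A = ⊆-antisym
        (∪-lub (λ x∈ → x∉p⇒x∈∁p (x∈p─q⇒x∉q F A x∈)) (p⊆q⇒∁p⊇∁q A⊆F))
        (λ {x} x∈∁A → case x ∈? F of λ where
           (yes x∈F) → p⊆p∪q _ (x∈p∧x∉q⇒x∈p─q x∈F (x∈∁p⇒x∉p x∈∁A))
           (no  x∉F) → q⊆p∪q _ _ (x∉p⇒x∈∁p x∉F))

    -- (M | ∁ G)* = M* / G
    dualRk-restriction : ∀ {G A} → A ⊆ ∁ G → dualRk (∁ G) rk A ≡ rk* (A ∪ G) ∸ rk* G
    dualRk-restriction {G} {A} A⊆∁G = begin
      (∣ A ∣) + rk (∁ G ─ A) ∸ rk (∁ G)
        ≡⟨ cancel (∣ A ∣) (∣ G ∣) (rk (∁ G ─ A)) (r≤∣A∣+rk∁A G) ⟩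
      ((∣ A ∣) + (∣ G ∣) + rk (∁ G ─ A) ∸ r) ∸ ((∣ G ∣) + rk (∁ G) ∸ r)
        ≡⟨ cong₂ (λ a X → (a + rk X ∸ r) ∸ ((∣ G ∣) + rk (∁ G) ∸ r)) (sym ∣A∪G∣) (sym ∁[A∪G]≡∁G─A) ⟩
      ((∣ A ∪ G ∣) + rk (∁ (A ∪ G)) ∸ r) ∸ ((∣ G ∣) + rk (∁ G) ∸ r)
        ≡⟨ cong₂ _∸_ (sym (rk*≡ (A ∪ G))) (sym (rk*≡ G)) ⟩
      rk* (A ∪ G) ∸ rk* G ∎
      where
      open ≡-Reasoning
      cancel : ∀ a g w {u} → r ≤ g + u → a + w ∸ u ≡ (a + g + w ∸ r) ∸ (g + u ∸ r)
      cancel a g w {u} r≤g+u = sym (begin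
        (a + g + w ∸ r) ∸ (g + u ∸ r) ≡⟨ ℕ.∸-+-assoc (a + g + w) r _ ⟩
        (a + g + w) ∸ (r + (g + u ∸ r)) ≡⟨ cong ((a + g + w) ∸_) (ℕ.m+[n∸m]≡n r≤g+u) ⟩
        (a + g + w) ∸ (g + u)           ≡⟨ cong (_∸ (g + u)) (swap a g w) ⟩
        (g + (a + w)) ∸ (g + u)         ≡⟨ ℕ.[m+n]∸[m+o]≡n∸o g (a + w) u ⟩
        a + w ∸ u                       ∎)
        where
        swap : ∀ a g w → a + g + w ≡ g + (a + w)
        swap = solve-∀
      ∣A∪G∣ : ∣ A ∪ G ∣ ≡ (∣ A ∣) + (∣ G ∣)
      ∣A∪G∣ = ∣p∪q∣≡∣p∣+∣q∣ A G (Empty-unique λ (x , x∈) →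
                let (x∈A , x∈G) = x∈p∩q⁻ A G x∈ in x∈∁p⇒x∉p (A⊆∁G x∈A) x∈G)
      ∁[A∪G]≡∁G─A : ∁ (A ∪ G) ≡ ∁ G ─ A
      ∁[A∪G]≡∁G─A = ⊆-antisym
        (λ x∈ → x∈p∧x∉q⇒x∈p─q (x∉p⇒x∈∁p (x∈∁p⇒x∉p x∈ ∘ q⊆p∪q A G)) (x∈∁p⇒x∉p x∈ ∘ p⊆p∪q G))
        (λ x∈ → x∉p⇒x∈∁p λ x∈A∪G →
          [ x∈p─q⇒x∉q (∁ G) A x∈ , x∈∁p⇒x∉p (p─q⊆p (∁ G) A x∈) ]′ (x∈p∪q⁻ A G x∈A∪G))

  dual : ∀ {n} → Matroid n → Matroid n
  dual M = record { rk = rk* ; rk-card = rk*-card ; rk-mono = rk*-mono ; rk-sub = rk*-sub }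
    where open Duality M

module Counting where
  open import Defs
  open Sums
  open MatroidTheory
  open import Data.Nat as ℕ using (ℕ; suc; _∸_)
  open import Data.Integer using (ℤ; +_; _*_)
  import Data.Integer.Properties as ℤ
  open import Data.Integer.Tactic.RingSolver using (solve-∀)
  open import Data.Fin.Subset
  open import Data.Fin.Subset.Properties
  open import Data.Product using (_,_; proj₂)
  open import Relation.Nullary.Decidable using (_×-dec_)
  open import Relation.Unary using (Decidable)
  open import Relation.Binary.PropositionalEquality
  import Algebra.Lattice.Properties.BooleanAlgebra as BooleanAlgebraProperties

  module ParallelClassCount {n : ℕ} (N : Matroid n) (rk-⁅⁆ : ∀ e → Matroid.rk N ⁅ e ⁆ ≡ 1) where
    open Matroid N
    open Closure N
    open Loopless N rk-⁅⁆

    numParClasses-contraction : ∀ {G E k} → IsFlat rk G → rk G ≡ k → (∀ {x} → x ∈ E → x ∉ G) → IsFlat rk (E ∪ G) →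
      ∀ r′ → (∀ A → A ⊆ E → r′ A ≡ rk (A ∪ G) ∸ k) →
      + numParClasses E r′ ≡ ∑ (λ P → 𝟙 (P ⊆? E) * 𝟙 (flatOfRank? rk (suc k) (P ∪ G)))
    numParClasses-contraction {G} {E} {k} G-flat rk-G E∩G≡∅ E∪G-flat r′ r′≡ =
      trans (countWhere≡∑ (isParClass? E r′)) (∑-cong λ P →
        trans (𝟙-cong (isParClass? E r′ P) ((P ⊆? E) ×-dec flatOfRank? rk (suc k) (P ∪ G))
                      (parClass⁻ P) (λ (P⊆E , P∪G-flat) → parClass⁺ P P⊆E P∪G-flat))
              (𝟙-× (P ⊆? E) (flatOfRank? rk (suc k) (P ∪ G))))
      where open ParallelClassesOfContraction G-flat rk-G E∩G≡∅ E∪G-flat r′ r′≡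

    numParClasses-restriction : ∀ {E} → IsFlat rk E → ∀ r′ → (∀ A → A ⊆ E → r′ A ≡ rk A) →
      + numParClasses E r′ ≡ ∑ (λ P → 𝟙 (P ⊆? E) * 𝟙 (flatOfRank? rk 1 P))
    numParClasses-restriction {E} E-flat r′ r′≡rk =
      trans (numParClasses-contraction ⊥-flat rk-⊥ (λ _ → ∉⊥) (subst (IsFlat rk) (sym (∪-identityʳ E)) E-flat) r′
                                       (λ A A⊆E → trans (r′≡rk A A⊆E) (cong rk (sym (∪-identityʳ A)))))
            (∑-cong λ P → cong (λ X → 𝟙 (P ⊆? E) * 𝟙 (flatOfRank? rk 1 X)) (∪-identityʳ P))

    numParClasses-above : ∀ {G} → FlatOfRank rk 1 G → ∀ r′ → (∀ A → A ⊆ ∁ G → r′ A ≡ rk (A ∪ G) ∸ 1) →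
      + numParClasses (∁ G) r′ ≡ weightAbove (flatOfRank? rk 2) (λ _ → + 1) G
    numParClasses-above {G} (G-flat , rk-G) r′ r′≡ = begin
      + numParClasses (∁ G) r′
        ≡⟨ numParClasses-contraction G-flat rk-G x∈∁p⇒x∉p ∁G∪G-flat r′ r′≡ ⟩
      ∑ (λ P → 𝟙 (P ⊆? ∁ G) * 𝟙 (flatOfRank? rk 2 (P ∪ G)))
        ≡⟨ ∑-supersets G (λ F → 𝟙 (flatOfRank? rk 2 F)) ⟩
      ∑ (λ F → 𝟙 (G ⊆? F) * 𝟙 (flatOfRank? rk 2 F))
        ≡⟨ ∑-cong (λ F → reorder (𝟙 (G ⊆? F)) (𝟙 (flatOfRank? rk 2 F))) ⟩
      weightAbove (flatOfRank? rk 2) (λ _ → + 1) G ∎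
      where
      open ≡-Reasoning
      ∁G∪G-flat : IsFlat rk (∁ G ∪ G)
      ∁G∪G-flat e _ = subst (e ∈_) (sym (trans (∪-comm (∁ G) G) (p∪∁p≡⊤ G))) ∈⊤
      reorder : ∀ a f → a * f ≡ f * (a * + 1)
      reorder = solve-∀

  module SeriesClasses {n : ℕ} (M : Matroid n) (noColoops : HasNoColoops M) where
    open Matroid M
    open Duality M
    open ParallelClassCount (dual M) (noColoops⇒rk*-⁅⁆ noColoops)
    open BooleanAlgebraProperties (∪-∩-booleanAlgebra n) using () renaming (¬-involutive to ∁-involutive)

    F₁? : Decidable (FlatOfRank rk* 1)
    F₁? = flatOfRank? rk* 1

    F₂? : Decidable (FlatOfRank rk* 2)
    F₂? = flatOfRank? rk* 2

    numSeriesClasses≡ : + numSeriesClasses ⊤ rk ≡ ∑ (λ F → 𝟙 (F₁? F))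
    numSeriesClasses≡ = trans (numParClasses-restriction (λ _ _ → ∈⊤) rk* (λ _ _ → refl))
                              (∑-cong λ F → trans (cong (_* 𝟙 (F₁? F)) (𝟙-yes (F ⊆? ⊤) ⊆⊤)) (ℤ.*-identityˡ _))

    numSeriesClasses-contraction : ∀ {F} → IsFlat rk* F →
      + numSeriesClasses (∁ (∁ F)) (contrRk rk (∁ F)) ≡ ∑ (λ G → 𝟙 (G ⊆? F) * 𝟙 (F₁? G))
    numSeriesClasses-contraction {F} F-flat =
      trans (cong (λ E → + numParClasses E (dualRk E (contrRk rk (∁ F)))) (∁-involutive F))
            (numParClasses-restriction F-flat (dualRk F (contrRk rk (∁ F))) (λ A → dualRk-contraction))

    numSeriesClasses-restriction : ∀ {G} → FlatOfRank rk* 1 G →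
      + numSeriesClasses (∁ G) rk ≡ weightAbove F₂? (λ _ → + 1) G
    numSeriesClasses-restriction {G} G∈F₁ =
      numParClasses-above G∈F₁ (dualRk (∁ G) rk)
        (λ A A⊆∁G → trans (dualRk-restriction A⊆∁G) (cong (rk* (A ∪ G) ∸_) (proj₂ G∈F₁)))

    -- Both sides count the pairs G ⊂ F of flats of M* of ranks 1 and 2.
    ∑-numSeriesClasses : ∑ (λ F → 𝟙 (F₂? F) * + numSeriesClasses (∁ (∁ F)) (contrRk rk (∁ F)))
                       ≡ ∑ (λ G → 𝟙 (F₁? G) * + numSeriesClasses (∁ G) rk)
    ∑-numSeriesClasses = begin
      ∑ (λ F → 𝟙 (F₂? F) * + numSeriesClasses (∁ (∁ F)) (contrRk rk (∁ F)))
        ≡⟨ ∑-cong (λ F → 𝟙*-cong (F₂? F) (λ (F-flat , _) → numSeriesClasses-contraction F-flat)) ⟩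
      ∑ (λ F → 𝟙 (F₂? F) * ∑ (λ G → 𝟙 (G ⊆? F) * 𝟙 (F₁? G)))
        ≡⟨ ∑-cong (λ F → sym (∑-*ˡ (𝟙 (F₂? F)) (λ G → 𝟙 (G ⊆? F) * 𝟙 (F₁? G)))) ⟩
      ∑ (λ F → ∑ (λ G → 𝟙 (F₂? F) * (𝟙 (G ⊆? F) * 𝟙 (F₁? G))))
        ≡⟨ ∑-swap (λ F G → 𝟙 (F₂? F) * (𝟙 (G ⊆? F) * 𝟙 (F₁? G))) ⟩
      ∑ (λ G → ∑ (λ F → 𝟙 (F₂? F) * (𝟙 (G ⊆? F) * 𝟙 (F₁? G))))
        ≡⟨ ∑-cong (λ G → trans (∑-cong λ F → reorder (𝟙 (F₂? F)) (𝟙 (G ⊆? F)) (𝟙 (F₁? G)))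
                               (∑-*ˡ (𝟙 (F₁? G)) (λ F → 𝟙 (F₂? F) * (𝟙 (G ⊆? F) * + 1)))) ⟩
      ∑ (λ G → 𝟙 (F₁? G) * weightAbove F₂? (λ _ → + 1) G)
        ≡⟨ ∑-cong (λ G → 𝟙*-cong (F₁? G) (λ G∈F₁ → sym (numSeriesClasses-restriction G∈F₁))) ⟩
      ∑ (λ G → 𝟙 (F₁? G) * + numSeriesClasses (∁ G) rk) ∎
      where
      open ≡-Reasoning
      reorder : ∀ f s g → f * (s * g) ≡ g * (f * (s * + 1))
      reorder = solve-∀

module Coefficients where
  open import Defs
  open Sums
  open PowerCoefficients
  open MatroidTheory
  open Counting
  open import Data.Nat as ℕ using (ℕ; suc; _∸_; _≤_; _<_; z≤n; s≤s; _≤?_)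
  import Data.Nat.Properties as ℕ
  open import Data.Nat.Combinatorics using (_C_; nC1≡n)
  open import Data.Integer using (ℤ; +_; -[1+_]; _+_; _-_; _*_; -_)
  import Data.Integer.Properties as ℤ
  open import Data.Integer.Tactic.RingSolver using (solve-∀)
  import Data.Bool as Bool
  open import Data.Fin.Subset hiding (_-_)
  open import Data.Fin.Subset.Properties
  import Data.Vec.Properties as Vec
  open import Data.Product using (_×_; _,_; proj₂)
  open import Relation.Nullary using (¬_; Dec; yes; no)
  open import Relation.Nullary.Decidable using (_×-dec_)
  open import Relation.Unary using (Decidable)
  open import Relation.Binary.PropositionalEquality
  import Algebra.Lattice.Properties.BooleanAlgebra as BooleanAlgebraProperties

  module TutteCoefficients {n : ℕ} (𝓜 : MultMatroid n) (noColoops : HasNoColoops (MultMatroid.matroid 𝓜)) where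
    open MultMatroid 𝓜 using (matroid; m; rk)
    open Duality matroid
    open Closure (dual matroid) using (closure; rk-closure; closure-flat; ⊆-closure; flat≡closure; closure-least)
      renaming (rk-⊥ to rk*-⊥)
    open Loopless (dual matroid) (noColoops⇒rk*-⁅⁆ noColoops) using (rk≡0⇒≡⊥; closure-cyclic)
    open SeriesClasses matroid noColoops
    open BooleanAlgebraProperties (∪-∩-booleanAlgebra n) using () renaming (¬⊥≈⊤ to ∁⊥≡⊤)

    CF₁? : Decidable (CyclicFlatOfRank rk* 1)
    CF₁? = cyclicFlatOfRank? rk* 1

    m* : Subset n → ℤ
    m* B = + m (∁ B)

    -- s(M), s(F̄) and s(M / F̄) in the notation of the statement, where F̄ = X ∖ F.
    sM : ℤ
    sM = + numSeriesClasses ⊤ rk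

    sRes : Subset n → ℤ
    sRes F = + numSeriesClasses (∁ F) rk

    sCon : Subset n → ℤ
    sCon F = + numSeriesClasses (∁ (∁ F)) (contrRk rk (∁ F))

    coeff-multTutte : ∀ i z → coeff (multTutte 𝓜) (+ i) z
                            ≡ ∑ (λ B → xm1PowCoeff (nullity* B) i * (xm1PowCoeffℤ (r* ∸ rk* B) z * m* B))
    coeff-multTutte i (+ j) = begin
      sumP (allSubsets n) (λ A → monoTerm (r ∸ rk A) (∣ A ∣ ∸ rk A) (+ m A)) i j
        ≡⟨ sumP-coeff (allSubsets n) _ i j ⟩
      ∑ (λ A → monoTerm (r ∸ rk A) (∣ A ∣ ∸ rk A) (+ m A) i j)
        ≡⟨ ∑-cong (λ A → monoTerm-coeff (r ∸ rk A) (∣ A ∣ ∸ rk A) (+ m A) i j) ⟩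
      ∑ (λ A → xm1PowCoeff (r ∸ rk A) i * (xm1PowCoeff (∣ A ∣ ∸ rk A) j * + m A))
        ≡⟨ ∑-∁ (λ A → xm1PowCoeff (r ∸ rk A) i * (xm1PowCoeff (∣ A ∣ ∸ rk A) j * + m A)) ⟩
      ∑ (λ B → xm1PowCoeff (nullity* B) i * (xm1PowCoeff (∣ ∁ B ∣ ∸ rk (∁ B)) j * m* B))
        ≡⟨ ∑-cong (λ B → cong (λ d → xm1PowCoeff (nullity* B) i * (xm1PowCoeff d j * m* B)) (nullity-∁ B)) ⟩
      ∑ (λ B → xm1PowCoeff (nullity* B) i * (xm1PowCoeff (r* ∸ rk* B) j * m* B)) ∎
      where open ≡-Reasoning
    coeff-multTutte i -[1+ _ ] = sym (∑-zero λ B →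
      trans (cong (xm1PowCoeff (nullity* B) i *_) (ℤ.*-zeroˡ (m* B))) (ℤ.*-zeroʳ (xm1PowCoeff (nullity* B) i)))

    n-r≡r* : + n - + r ≡ + r*
    n-r≡r* = trans (ℤ.[+m]-[+n]≡m⊖n n r) (ℤ.⊖-≥ r≤n)

    yFactor : Subset n → ℕ → ℤ
    yFactor B k = xm1PowCoeffℤ (r* ∸ rk* B) (+ r* - + k)

    coeff-at : ∀ i k → coeff (multTutte 𝓜) (+ i) (+ n - + r - + k)
                     ≡ ∑ (λ B → xm1PowCoeff (nullity* B) i * (yFactor B k * m* B))
    coeff-at i k = trans (coeff-multTutte i (+ n - + r - + k)) (∑-cong λ B →
      cong (λ z → xm1PowCoeff (nullity* B) i * (xm1PowCoeffℤ (r* ∸ rk* B) z * m* B)) (cong (_- + k) n-r≡r*))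

    yFactor-≤ : ∀ B k → rk* B ≤ k → yFactor B k ≡ sgn (k ∸ rk* B) * + ((r* ∸ rk* B) C (k ∸ rk* B))
    yFactor-≤ B k = xm1PowCoeffℤ-shift (rk*≤r* B)

    yFactor-> : ∀ B k → k < rk* B → yFactor B k ≡ + 0
    yFactor-> B k = xm1PowCoeffℤ-shift-> (rk*≤r* B)

    yFactor-≡ : ∀ B k → rk* B ≡ k → yFactor B k ≡ + 1
    yFactor-≡ B k rk*B≡k = trans (yFactor-≤ B k (ℕ.≤-reflexive rk*B≡k))
      (cong (λ d → sgn d * + ((r* ∸ rk* B) C d)) (trans (cong (k ∸_) rk*B≡k) (ℕ.n∸n≡0 k)))

    yFactor-⊥ : ∀ k → yFactor ⊥ k ≡ sgn k * + (r* C k)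
    yFactor-⊥ k = trans (yFactor-≤ ⊥ k (subst (_≤ k) (sym rk*-⊥) z≤n))
      (cong (λ ρ → sgn (k ∸ ρ) * + ((r* ∸ ρ) C (k ∸ ρ))) rk*-⊥)

    yFactor-1-2 : ∀ B → rk* B ≡ 1 → yFactor B 2 ≡ - (+ r* - + 1)
    yFactor-1-2 B rk*B≡1 = begin
      yFactor B 2                                        ≡⟨ yFactor-≤ B 2 (ℕ.≤-trans (ℕ.≤-reflexive rk*B≡1) (s≤s z≤n)) ⟩
      sgn (2 ∸ rk* B) * + ((r* ∸ rk* B) C (2 ∸ rk* B))
        ≡⟨ cong (λ ρ → sgn (2 ∸ ρ) * + ((r* ∸ ρ) C (2 ∸ ρ))) rk*B≡1 ⟩
      - (+ 1) * + ((r* ∸ 1) C 1)                         ≡⟨ cong (λ t → - (+ 1) * + t) (nC1≡n (r* ∸ 1)) ⟩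
      - (+ 1) * + (r* ∸ 1)                               ≡⟨ ℤ.-1*i≡-i (+ (r* ∸ 1)) ⟩
      - + (r* ∸ 1)                                       ≡⟨ cong -_ (sym (trans (ℤ.[+m]-[+n]≡m⊖n r* 1) (ℤ.⊖-≥ 1≤r*))) ⟩
      - (+ r* - + 1)                                     ∎
      where
      open ≡-Reasoning
      1≤r* : 1 ≤ r*
      1≤r* = ℕ.≤-trans (ℕ.≤-reflexive (sym rk*B≡1)) (rk*≤r* B)

    nullity*-⊥ : nullity* ⊥ ≡ 0
    nullity*-⊥ = trans (cong (λ X → r ∸ rk X) ∁⊥≡⊤) (ℕ.n∸n≡0 r)

    ∣B∣≡ : ∀ {B j} → rk* B ≡ j → ∣ B ∣ ≡ nullity* B ℕ.+ j
    ∣B∣≡ {B} rk*B≡j = trans (sym (nullity*+rk* B)) (cong (nullity* B ℕ.+_) rk*B≡j)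

    sgn-∣B∣ : ∀ {B j} → rk* B ≡ j → sgn ∣ B ∣ ≡ sgn (nullity* B) * sgn j
    sgn-∣B∣ {B} {j} rk*B≡j = trans (cong sgn (∣B∣≡ rk*B≡j)) (sgn-+ (nullity* B) j)

    sgn-∣B∣+1 : ∀ {B j} → rk* B ≡ j → sgn (∣ B ∣ ℕ.+ 1) ≡ sgn (nullity* B) * sgn (suc j)
    sgn-∣B∣+1 {B} {j} rk*B≡j = trans (cong sgn (trans (cong (ℕ._+ 1) (∣B∣≡ rk*B≡j)) (ℕ.+-assoc (nullity* B) j 1)))
      (trans (sgn-+ (nullity* B) (j ℕ.+ 1)) (cong (λ t → sgn (nullity* B) * sgn t) (ℕ.+-comm j 1)))

    data RankView (B : Subset n) : Set where
      rank0  : B ≡ ⊥     → RankView B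
      rank1  : rk* B ≡ 1 → RankView B
      rank2  : rk* B ≡ 2 → RankView B
      rank≥3 : 2 < rk* B → RankView B

    rankView : ∀ B → RankView B
    rankView B with rk* B in eq
    ... | 0                 = rank0 (rk≡0⇒≡⊥ eq)
    ... | 1                 = rank1 eq
    ... | 2                 = rank2 eq
    ... | suc (suc (suc _)) = rank≥3 (subst (2 <_) (sym eq) (s≤s (s≤s (s≤s z≤n))))

    _≟⊥ : (B : Subset n) → Dec (B ≡ ⊥)
    B ≟⊥ = Vec.≡-dec Bool._≟_ B ⊥

    0<rk*⇒≢⊥ : ∀ {B} → 0 < rk* B → B ≢ ⊥
    0<rk*⇒≢⊥ 0<rk*B refl = ℕ.<⇒≢ 0<rk*B (sym rk*-⊥)

    at-⊥ : ∀ K → K * + m ⊤ ≡ ∑ (λ B → 𝟙 (B ≟⊥) * (K * m* B))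
    at-⊥ K = sym (begin
      ∑ (λ B → 𝟙 (B ≟⊥) * (K * m* B)) ≡⟨ ∑-single ⊥ (λ B B≢⊥ → cong (_* (K * m* B)) (𝟙-no (B ≟⊥) B≢⊥)) ⟩
      𝟙 (⊥ ≟⊥) * (K * m* ⊥)           ≡⟨ cong (_* (K * m* ⊥)) (𝟙-yes (⊥ ≟⊥) refl) ⟩
      + 1 * (K * m* ⊥)                 ≡⟨ ℤ.*-identityˡ _ ⟩
      K * + m (∁ ⊥)                    ≡⟨ cong (λ X → K * + m X) ∁⊥≡⊤ ⟩
      K * + m ⊤                        ∎)
      where open ≡-Reasoning

    weightAbove-rank : ∀ j w {A} → rk* A ≡ j → weightAbove (flatOfRank? rk* j) w A ≡ w (closure A)
    weightAbove-rank j w {A} rk*A≡j = weightAbove-single (flatOfRank? rk* j) w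
      (λ F (F-flat , rk*F≡j) A⊆F → flat≡closure F-flat A⊆F (trans rk*F≡j (sym rk*A≡j)))
      (closure-flat A , trans (rk-closure A) rk*A≡j) (⊆-closure A)

    weightAbove-> : ∀ {P : Subset n → Set} (P? : ∀ F → Dec (P F)) {j} → (∀ {F} → P F → rk* F ≡ j) →
                    ∀ w {A} → j < rk* A → weightAbove P? w A ≡ + 0
    weightAbove-> P? rk*≡j w {A} j<rk*A = weightAbove-none P? w λ F P-F A⊆F →
      ℕ.<⇒≱ j<rk*A (ℕ.≤-trans (rk*-mono A F A⊆F) (ℕ.≤-reflexive (rk*≡j P-F)))

    weightAbove-cyclic : ∀ w {A} → rk* A ≡ 1 → 2 ≤ ∣ A ∣ → weightAbove CF₁? w A ≡ w (closure A)
    weightAbove-cyclic w {A} rk*A≡1 2≤∣A∣ = weightAbove-single CF₁? w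
      (λ F ((F-flat , _) , rk*F≡1) A⊆F → flat≡closure F-flat A⊆F (trans rk*F≡1 (sym rk*A≡1)))
      (closure-cyclic rk*A≡1 2≤∣A∣ , trans (rk-closure A) rk*A≡1) (⊆-closure A)

    weightAbove-F₂ : ∀ {A} → rk* A ≡ 1 → weightAbove F₂? (λ _ → + 1) A ≡ sRes (closure A)
    weightAbove-F₂ {A} rk*A≡1 = trans
      (∑-cong λ F → 𝟙*-cong (F₂? F) λ (F-flat , _) →
        cong (_* + 1) (𝟙-cong (A ⊆? F) (closure A ⊆? F) (closure-least F-flat) (⊆-trans (⊆-closure A))))
      (sym (numSeriesClasses-restriction (closure-flat A , trans (rk-closure A) rk*A≡1)))

    ≢⊥⇒0<rk* : ∀ {B} → B ≢ ⊥ → 0 < rk* B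
    ≢⊥⇒0<rk* B≢⊥ = ℕ.n≢0⇒n>0 (λ rk*B≡0 → B≢⊥ (rk≡0⇒≡⊥ rk*B≡0))

    weightAbove-⊥-F₁ : weightAbove F₁? (λ _ → + 1) ⊥ ≡ sM
    weightAbove-⊥-F₁ = trans (weightAbove-⊥ F₁? (λ _ → + 1))
      (trans (∑-cong λ F → ℤ.*-identityʳ (𝟙 (F₁? F))) (sym numSeriesClasses≡))

    summand₁ : ∀ B → xm1PowCoeff (nullity* B) 0 * (yFactor B 0 * m* B) ≡ 𝟙 (B ≟⊥) * (+ 1 * m* B)
    summand₁ B with B ≟⊥
    ... | yes refl = cong₂ (λ ν y → xm1PowCoeff ν 0 * (y * m* ⊥)) nullity*-⊥ (yFactor-≡ ⊥ 0 rk*-⊥)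
    ... | no  B≢⊥  = trans (cong (λ y → xm1PowCoeff (nullity* B) 0 * (y * m* B)) (yFactor-> B 0 (≢⊥⇒0<rk* B≢⊥)))
                           (ℤ.*-zeroʳ (xm1PowCoeff (nullity* B) 0))

    coeff-0-0 : coeff (multTutte 𝓜) (+ 0) (+ n - + r) ≡ + m ⊤
    coeff-0-0 = begin
      coeff (multTutte 𝓜) (+ 0) (+ n - + r)                         ≡⟨ cong (coeff _ (+ 0)) (sym (ℤ.+-identityʳ (+ n - + r))) ⟩
      coeff (multTutte 𝓜) (+ 0) (+ n - + r - + 0)                   ≡⟨ coeff-at 0 0 ⟩
      ∑ (λ B → xm1PowCoeff (nullity* B) 0 * (yFactor B 0 * m* B))  ≡⟨ ∑-cong summand₁ ⟩
      ∑ (λ B → 𝟙 (B ≟⊥) * (+ 1 * m* B))                           ≡⟨ sym (at-⊥ (+ 1)) ⟩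
      + 1 * + m ⊤                                                  ≡⟨ ℤ.*-identityˡ _ ⟩
      + m ⊤                                                        ∎
      where open ≡-Reasoning

    h₂ : Subset n → ℤ
    h₂ A = sgn (∣ A ∣ ℕ.+ 1) * m* A

    summand₂-vanishes : ∀ B → 1 < rk* B → xm1PowCoeff (nullity* B) 0 * (yFactor B 1 * m* B)
                                 ≡ 𝟙 (B ≟⊥) * ((sM - + r*) * m* B) + h₂ B * weightAbove F₁? (λ _ → + 1) B
    summand₂-vanishes B 1<rk*B = trans
      (cong (λ y → xm1PowCoeff (nullity* B) 0 * (y * m* B)) (yFactor-> B 1 1<rk*B))
      (trans (identity (xm1PowCoeff (nullity* B) 0) (m* B) ((sM - + r*) * m* B) (h₂ B))
      (sym (cong₂ _+_ (cong (_* ((sM - + r*) * m* B)) (𝟙-no (B ≟⊥) (0<rk*⇒≢⊥ (ℕ.<-trans (s≤s z≤n) 1<rk*B))))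
                      (cong (h₂ B *_) (weightAbove-> F₁? proj₂ _ 1<rk*B)))))
      where
      identity : ∀ x m k h → x * (+ 0 * m) ≡ + 0 * k + h * + 0
      identity = solve-∀

    summand₂ : ∀ B → RankView B → xm1PowCoeff (nullity* B) 0 * (yFactor B 1 * m* B)
                              ≡ 𝟙 (B ≟⊥) * ((sM - + r*) * m* B) + h₂ B * weightAbove F₁? (λ _ → + 1) B
    summand₂ B (rank0 refl) = trans
      (cong₂ (λ ν y → xm1PowCoeff ν 0 * (y * m* ⊥)) nullity*-⊥
             (trans (yFactor-⊥ 1) (cong (λ t → - + 1 * + t) (nC1≡n r*))))
      (trans (identity (+ r*) sM (m* ⊥))
      (sym (cong₂ _+_ (cong (_* ((sM - + r*) * m* ⊥)) (𝟙-yes (⊥ ≟⊥) refl))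
                      (cong₂ (λ s w → sgn (s ℕ.+ 1) * m* ⊥ * w) (∣⊥∣≡0 n) weightAbove-⊥-F₁))))
      where
      identity : ∀ c s m → + 1 * (- + 1 * c * m) ≡ + 1 * ((s - c) * m) + - + 1 * m * s
      identity = solve-∀

    summand₂ B (rank1 rk*B≡1) = trans
      (cong₂ (λ x y → x * (y * m* B)) (xm1PowCoeff-0 (nullity* B)) (yFactor-≡ B 1 rk*B≡1))
      (trans (identity (sgn (nullity* B)) (m* B) ((sM - + r*) * m* B))
      (sym (cong₂ _+_ (cong (_* ((sM - + r*) * m* B)) (𝟙-no (B ≟⊥) (0<rk*⇒≢⊥ (ℕ.≤-reflexive (sym rk*B≡1)))))
                      (cong₂ (λ s w → s * m* B * w) (sgn-∣B∣+1 rk*B≡1) (weightAbove-rank 1 _ rk*B≡1)))))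
      where
      identity : ∀ s m k → s * (+ 1 * m) ≡ + 0 * k + s * + 1 * m * + 1
      identity = solve-∀

    summand₂ B (rank2 rk*B≡2)  = summand₂-vanishes B (ℕ.≤-reflexive (sym rk*B≡2))
    summand₂ B (rank≥3 2<rk*B) = summand₂-vanishes B (ℕ.<⇒≤ 2<rk*B)

    coeff-0-1 : coeff (multTutte 𝓜) (+ 0) (+ n - + r - + 1)
              ≡ (sM - (+ n - + r)) * + m ⊤ + sumWhere (FlatOfRank rk* 1) F₁? (λ F → sumWhere (_⊆ F) (_⊆? F) h₂)
    coeff-0-1 = begin
      coeff (multTutte 𝓜) (+ 0) (+ n - + r - + 1)
        ≡⟨ coeff-at 0 1 ⟩
      ∑ (λ B → xm1PowCoeff (nullity* B) 0 * (yFactor B 1 * m* B))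
        ≡⟨ ∑-cong (λ B → summand₂ B (rankView B)) ⟩
      ∑ (λ B → 𝟙 (B ≟⊥) * ((sM - + r*) * m* B) + h₂ B * weightAbove F₁? (λ _ → + 1) B)
        ≡⟨ ∑-+ (λ B → 𝟙 (B ≟⊥) * ((sM - + r*) * m* B)) (λ B → h₂ B * weightAbove F₁? (λ _ → + 1) B) ⟩
      ∑ (λ B → 𝟙 (B ≟⊥) * ((sM - + r*) * m* B)) + ∑ (λ B → h₂ B * weightAbove F₁? (λ _ → + 1) B)
        ≡⟨ cong₂ _+_ (sym (at-⊥ (sM - + r*))) (sym (sumWhere-⊆₁ F₁? h₂)) ⟩
      (sM - + r*) * + m ⊤ + sumWhere (FlatOfRank rk* 1) F₁? (λ F → sumWhere (_⊆ F) (_⊆? F) h₂)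
        ≡⟨ cong (λ c → (sM - c) * + m ⊤ + sumWhere (FlatOfRank rk* 1) F₁? (λ F → sumWhere (_⊆ F) (_⊆? F) h₂))
                (sym n-r≡r*) ⟩
      (sM - (+ n - + r)) * + m ⊤ + sumWhere (FlatOfRank rk* 1) F₁? (λ F → sumWhere (_⊆ F) (_⊆? F) h₂) ∎
      where open ≡-Reasoning

    *-vanishʳ : ∀ a {w} → w ≡ + 0 → a * w ≡ + 0
    *-vanishʳ a w≡0 = trans (cong (a *_) w≡0) (ℤ.*-zeroʳ a)

    N₂ : ℤ
    N₂ = ∑ (λ F → 𝟙 (F₂? F))

    T : ℤ
    T = ∑ (λ G → 𝟙 (F₁? G) * sRes G)

    w₁ : ℤ → Subset n → ℤ
    w₁ c F = sRes F - c + + 1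

    ∑F₂[sCon-1] : sumWhere (FlatOfRank rk* 2) F₂? (λ F → sCon F - + 1) ≡ T + - + 1 * N₂
    ∑F₂[sCon-1] = begin
      sumWhere (FlatOfRank rk* 2) F₂? (λ F → sCon F - + 1)    ≡⟨ sumWhere≡∑ F₂? (λ F → sCon F - + 1) ⟩
      ∑ (λ F → 𝟙 (F₂? F) * (sCon F - + 1))                    ≡⟨ ∑-*-+ (λ F → 𝟙 (F₂? F)) sCon (- + 1) ⟩
      ∑ (λ F → 𝟙 (F₂? F) * sCon F) + - + 1 * N₂               ≡⟨ cong (_+ - + 1 * N₂) ∑-numSeriesClasses ⟩
      T + - + 1 * N₂                                          ∎
      where open ≡-Reasoning

    weightAbove-⊥-w₁ : weightAbove F₁? (w₁ (+ r*)) ⊥ ≡ T + - + r* * sM + + 1 * sM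
    weightAbove-⊥-w₁ = begin
      weightAbove F₁? (w₁ (+ r*)) ⊥
        ≡⟨ weightAbove-⊥ F₁? (w₁ (+ r*)) ⟩
      ∑ (λ F → 𝟙 (F₁? F) * (sRes F - + r* + + 1))
        ≡⟨ ∑-*-+ (λ F → 𝟙 (F₁? F)) (λ F → sRes F - + r*) (+ 1) ⟩
      ∑ (λ F → 𝟙 (F₁? F) * (sRes F - + r*)) + + 1 * ∑ (λ F → 𝟙 (F₁? F))
        ≡⟨ cong₂ (λ s t → s + + 1 * t) (∑-*-+ (λ F → 𝟙 (F₁? F)) sRes (- + r*)) (sym numSeriesClasses≡) ⟩
      T + - + r* * ∑ (λ F → 𝟙 (F₁? F)) + + 1 * sM
        ≡⟨ cong (λ t → T + - + r* * t + + 1 * sM) (sym numSeriesClasses≡) ⟩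
      T + - + r* * sM + + 1 * sM ∎
      where open ≡-Reasoning

    weightAbove-⊥-F₂ : weightAbove F₂? (λ _ → + 1) ⊥ ≡ N₂
    weightAbove-⊥-F₂ = trans (weightAbove-⊥ F₂? (λ _ → + 1)) (∑-cong λ F → ℤ.*-identityʳ (𝟙 (F₂? F)))

    K₃ : ℤ → ℤ
    K₃ c = + (r* C 2) - (c - + 1) * sM + sumWhere (FlatOfRank rk* 2) F₂? (λ F → sCon F - + 1)

    h₃ : Subset n → ℤ
    h₃ A = sgn ∣ A ∣ * m* A

    RHS₃ : ℤ → ℤ
    RHS₃ c = K₃ c * + m ⊤ + sumWhere (FlatOfRank rk* 1) F₁? (λ F → w₁ c F * sumWhere (_⊆ F) (_⊆? F) h₂)
                        + sumWhere (FlatOfRank rk* 2) F₂? (λ F → sumWhere (_⊆ F) (_⊆? F) h₃)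

    rhs₃ : Subset n → ℤ
    rhs₃ B = 𝟙 (B ≟⊥) * (K₃ (+ r*) * m* B) + h₂ B * weightAbove F₁? (w₁ (+ r*)) B + h₃ B * weightAbove F₂? (λ _ → + 1) B

    summand₃ : ∀ B → RankView B → xm1PowCoeff (nullity* B) 0 * (yFactor B 2 * m* B) ≡ rhs₃ B
    summand₃ B (rank0 refl) = trans
      (cong₂ (λ ν y → xm1PowCoeff ν 0 * (y * m* ⊥)) nullity*-⊥ (yFactor-⊥ 2))
      (trans (identity (+ (r* C 2)) (+ r*) sM T N₂ (m* ⊥))
      (sym (cong₂ _+_ (cong₂ _+_
        (cong₂ (λ i s → i * ((+ (r* C 2) - (+ r* - + 1) * sM + s) * m* ⊥)) (𝟙-yes (⊥ ≟⊥) refl) ∑F₂[sCon-1])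
        (cong₂ (λ s w → sgn (s ℕ.+ 1) * m* ⊥ * w) (∣⊥∣≡0 n) weightAbove-⊥-w₁))
        (cong₂ (λ s w → sgn s * m* ⊥ * w) (∣⊥∣≡0 n) weightAbove-⊥-F₂))))
      where
      identity : ∀ C c s t N m → + 1 * (+ 1 * C * m)
               ≡ + 1 * ((C - (c - + 1) * s + (t + - + 1 * N)) * m) + - + 1 * m * (t + - c * s + + 1 * s) + + 1 * m * N
      identity = solve-∀

    summand₃ B (rank1 rk*B≡1) = trans
      (cong₂ (λ x y → x * (y * m* B)) (xm1PowCoeff-0 (nullity* B)) (yFactor-1-2 B rk*B≡1))
      (trans (identity (sgn (nullity* B)) (+ r*) (sRes (closure B)) (m* B) (K₃ (+ r*) * m* B))
      (sym (cong₂ _+_ (cong₂ _+_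
        (cong (_* (K₃ (+ r*) * m* B)) (𝟙-no (B ≟⊥) (0<rk*⇒≢⊥ (ℕ.≤-reflexive (sym rk*B≡1)))))
        (cong₂ (λ s w → s * m* B * w) (sgn-∣B∣+1 rk*B≡1) (weightAbove-rank 1 (w₁ (+ r*)) rk*B≡1)))
        (cong₂ (λ s w → s * m* B * w) (sgn-∣B∣ rk*B≡1) (weightAbove-F₂ rk*B≡1)))))
      where
      identity : ∀ s c σ m k → s * (- (c - + 1) * m)
               ≡ + 0 * k + s * (- + 1 * - + 1) * m * (σ - c + + 1) + s * - + 1 * m * σ
      identity = solve-∀

    summand₃ B (rank2 rk*B≡2) = trans
      (cong₂ (λ x y → x * (y * m* B)) (xm1PowCoeff-0 (nullity* B)) (yFactor-≡ B 2 rk*B≡2))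
      (trans (identity (sgn (nullity* B)) (m* B) (K₃ (+ r*) * m* B) (h₂ B))
      (sym (cong₂ _+_ (cong₂ _+_
        (cong (_* (K₃ (+ r*) * m* B)) (𝟙-no (B ≟⊥) (0<rk*⇒≢⊥ (ℕ.≤-trans (s≤s z≤n) (ℕ.≤-reflexive (sym rk*B≡2))))))
        (cong (h₂ B *_) (weightAbove-> F₁? proj₂ (w₁ (+ r*)) (ℕ.≤-reflexive (sym rk*B≡2)))))
        (cong₂ (λ s w → s * m* B * w) (sgn-∣B∣ rk*B≡2) (weightAbove-rank 2 _ rk*B≡2)))))
      where
      identity : ∀ s m k h → s * (+ 1 * m) ≡ + 0 * k + h * + 0 + s * (- + 1 * - + 1) * m * + 1
      identity = solve-∀

    summand₃ B (rank≥3 2<rk*B) = trans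
      (*-vanishʳ (xm1PowCoeff (nullity* B) 0) (cong (_* m* B) (yFactor-> B 2 2<rk*B)))
      (sym (cong₂ _+_ (cong₂ _+_
        (cong (_* (K₃ (+ r*) * m* B)) (𝟙-no (B ≟⊥) (0<rk*⇒≢⊥ (ℕ.<-trans (s≤s z≤n) 2<rk*B))))
        (*-vanishʳ (h₂ B) (weightAbove-> F₁? proj₂ (w₁ (+ r*)) (ℕ.<⇒≤ 2<rk*B))))
        (*-vanishʳ (h₃ B) (weightAbove-> F₂? proj₂ _ 2<rk*B))))

    coeff-0-2 : coeff (multTutte 𝓜) (+ 0) (+ n - + r - + 2) ≡ RHS₃ (+ n - + r)
    coeff-0-2 = begin
      coeff (multTutte 𝓜) (+ 0) (+ n - + r - + 2)
        ≡⟨ coeff-at 0 2 ⟩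
      ∑ (λ B → xm1PowCoeff (nullity* B) 0 * (yFactor B 2 * m* B))
        ≡⟨ ∑-cong (λ B → summand₃ B (rankView B)) ⟩
      ∑ rhs₃
        ≡⟨ ∑-+ (λ B → 𝟙 (B ≟⊥) * (K₃ (+ r*) * m* B) + h₂ B * weightAbove F₁? (w₁ (+ r*)) B)
               (λ B → h₃ B * weightAbove F₂? (λ _ → + 1) B) ⟩
      ∑ (λ B → 𝟙 (B ≟⊥) * (K₃ (+ r*) * m* B) + h₂ B * weightAbove F₁? (w₁ (+ r*)) B)
        + ∑ (λ B → h₃ B * weightAbove F₂? (λ _ → + 1) B)
        ≡⟨ cong (_+ ∑ (λ B → h₃ B * weightAbove F₂? (λ _ → + 1) B))
                (∑-+ (λ B → 𝟙 (B ≟⊥) * (K₃ (+ r*) * m* B)) (λ B → h₂ B * weightAbove F₁? (w₁ (+ r*)) B)) ⟩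
      ∑ (λ B → 𝟙 (B ≟⊥) * (K₃ (+ r*) * m* B)) + ∑ (λ B → h₂ B * weightAbove F₁? (w₁ (+ r*)) B)
        + ∑ (λ B → h₃ B * weightAbove F₂? (λ _ → + 1) B)
        ≡⟨ cong₂ _+_ (cong₂ _+_ (sym (at-⊥ (K₃ (+ r*)))) (sym (sumWhere-⊆ F₁? (w₁ (+ r*)) h₂)))
                     (sym (sumWhere-⊆₁ F₂? h₃)) ⟩
      RHS₃ (+ r*)
        ≡⟨ cong RHS₃ (sym n-r≡r*) ⟩
      RHS₃ (+ n - + r) ∎
      where open ≡-Reasoning

    nullity*< : ∀ {B j k} → rk* B ≡ j → ¬ (k ℕ.+ j ≤ ∣ B ∣) → nullity* B < k
    nullity*< {B} {j} {k} rk*B≡j ≰ = ℕ.+-cancelʳ-< j (nullity* B) k (subst (_< k ℕ.+ j) (∣B∣≡ rk*B≡j) (ℕ.≰⇒> ≰))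

    +∣B∣≡ : ∀ {B j} → rk* B ≡ j → + ∣ B ∣ ≡ + nullity* B + + j
    +∣B∣≡ {B} {j} rk*B≡j = trans (cong +_ (∣B∣≡ rk*B≡j)) (ℤ.pos-+ (nullity* B) j)

    𝟙-≤?-⊥ : ∀ k → 0 < k → 𝟙 (k ≤? ∣ ⊥ {n} ∣) ≡ + 0
    𝟙-≤?-⊥ k 0<k = 𝟙-no (k ≤? ∣ ⊥ {n} ∣) λ k≤∣⊥∣ → ℕ.<⇒≱ 0<k (subst (k ≤_) (∣⊥∣≡0 n) k≤∣⊥∣)

    h₄ : Subset n → ℤ
    h₄ A = sgn ∣ A ∣ * (+ ∣ A ∣ - + 1) * m* A

    h₄-rank1 : ∀ {B} → rk* B ≡ 1 → h₄ B ≡ sgn (nullity* B) * - + 1 * (+ nullity* B + + 1 - + 1) * m* B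
    h₄-rank1 {B} rk*B≡1 = cong₂ (λ s k → s * (k - + 1) * m* B) (sgn-∣B∣ rk*B≡1) (+∣B∣≡ rk*B≡1)

    summand₄-vanishes : ∀ B → 1 < rk* B → xm1PowCoeff (nullity* B) 1 * (yFactor B 1 * m* B)
                                 ≡ (𝟙 (2 ≤? ∣ B ∣) * h₄ B) * weightAbove CF₁? (λ _ → + 1) B
    summand₄-vanishes B 1<rk*B = trans
      (*-vanishʳ (xm1PowCoeff (nullity* B) 1) (cong (_* m* B) (yFactor-> B 1 1<rk*B)))
      (sym (*-vanishʳ (𝟙 (2 ≤? ∣ B ∣) * h₄ B) (weightAbove-> CF₁? proj₂ _ 1<rk*B)))

    summand₄ : ∀ B → RankView B → xm1PowCoeff (nullity* B) 1 * (yFactor B 1 * m* B)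
                              ≡ (𝟙 (2 ≤? ∣ B ∣) * h₄ B) * weightAbove CF₁? (λ _ → + 1) B
    summand₄ B (rank0 refl) = trans (cong (λ ν → xm1PowCoeff ν 1 * (yFactor ⊥ 1 * m* ⊥)) nullity*-⊥)
      (sym (cong (λ i → i * h₄ ⊥ * weightAbove CF₁? (λ _ → + 1) ⊥) (𝟙-≤?-⊥ 2 (s≤s z≤n))))

    summand₄ B (rank1 rk*B≡1) = rank1-term (2 ≤? ∣ B ∣)
      where
      rank1-term : Dec (2 ≤ ∣ B ∣) → xm1PowCoeff (nullity* B) 1 * (yFactor B 1 * m* B)
                                      ≡ (𝟙 (2 ≤? ∣ B ∣) * h₄ B) * weightAbove CF₁? (λ _ → + 1) B
      rank1-term (yes 2≤∣B∣) = trans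
        (cong₂ (λ x y → x * (y * m* B)) (xm1PowCoeff-1 (nullity* B)) (yFactor-≡ B 1 rk*B≡1))
        (trans (identity (sgn (nullity* B)) (+ nullity* B) (m* B))
        (sym (trans (cong₂ (λ i w → i * h₄ B * w) (𝟙-yes (2 ≤? ∣ B ∣) 2≤∣B∣)
                                                   (weightAbove-cyclic _ rk*B≡1 2≤∣B∣))
                    (cong (λ h → + 1 * h * + 1) (h₄-rank1 rk*B≡1)))))
        where
        identity : ∀ s ν m → - s * ν * (+ 1 * m) ≡ + 1 * (s * - + 1 * (ν + + 1 - + 1) * m) * + 1
        identity = solve-∀
      rank1-term (no 2≰∣B∣) = trans (cong (_* (yFactor B 1 * m* B)) (xm1PowCoeff-> (nullity*< {k = 1} rk*B≡1 2≰∣B∣)))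
        (sym (cong (λ i → i * h₄ B * weightAbove CF₁? (λ _ → + 1) B) (𝟙-no (2 ≤? ∣ B ∣) 2≰∣B∣)))

    summand₄ B (rank2 rk*B≡2) = summand₄-vanishes B (ℕ.≤-reflexive (sym rk*B≡2))
    summand₄ B (rank≥3 2<rk*B) = summand₄-vanishes B (ℕ.<⇒≤ 2<rk*B)

    coeff-1-1 : coeff (multTutte 𝓜) (+ 1) (+ n - + r - + 1)
              ≡ sumWhere (CyclicFlatOfRank rk* 1) CF₁?
                  (λ F → sumWhere (λ A → A ⊆ F × 2 ≤ ∣ A ∣) (λ A → (A ⊆? F) ×-dec (2 ≤? ∣ A ∣)) h₄)
    coeff-1-1 = begin
      coeff (multTutte 𝓜) (+ 1) (+ n - + r - + 1)                        ≡⟨ coeff-at 1 1 ⟩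
      ∑ (λ B → xm1PowCoeff (nullity* B) 1 * (yFactor B 1 * m* B))       ≡⟨ ∑-cong (λ B → summand₄ B (rankView B)) ⟩
      ∑ (λ B → (𝟙 (2 ≤? ∣ B ∣) * h₄ B) * weightAbove CF₁? (λ _ → + 1) B) ≡⟨ sym (sumWhere-⊆≥₁ CF₁? 2 h₄) ⟩
      sumWhere (CyclicFlatOfRank rk* 1) CF₁?
        (λ F → sumWhere (λ A → A ⊆ F × 2 ≤ ∣ A ∣) (λ A → (A ⊆? F) ×-dec (2 ≤? ∣ A ∣)) h₄) ∎
      where open ≡-Reasoning

    h₅ : Subset n → ℤ
    h₅ A = sgn (∣ A ∣ ℕ.+ 1) * + nullity* A * m* A

    RHS₅ : ℤ → ℤ
    RHS₅ c = sumWhere (CyclicFlatOfRank rk* 1) CF₁?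
              (λ F → w₁ c F * sumWhere (λ A → A ⊆ F × 2 ≤ ∣ A ∣) (λ A → (A ⊆? F) ×-dec (2 ≤? ∣ A ∣)) h₄)
          + sumWhere (FlatOfRank rk* 2) F₂?
              (λ F → sumWhere (λ A → A ⊆ F × 2 ≤ ∣ A ∣) (λ A → (A ⊆? F) ×-dec (2 ≤? ∣ A ∣)) h₅)

    rhs₅ : Subset n → ℤ
    rhs₅ B = (𝟙 (2 ≤? ∣ B ∣) * h₄ B) * weightAbove CF₁? (w₁ (+ r*)) B
          + (𝟙 (2 ≤? ∣ B ∣) * h₅ B) * weightAbove F₂? (λ _ → + 1) B

    rhs₅-𝟙 : ∀ B {i} → 𝟙 (2 ≤? ∣ B ∣) ≡ i
          → rhs₅ B ≡ (i * h₄ B) * weightAbove CF₁? (w₁ (+ r*)) B + (i * h₅ B) * weightAbove F₂? (λ _ → + 1) B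
    rhs₅-𝟙 B = cong (λ i → (i * h₄ B) * weightAbove CF₁? (w₁ (+ r*)) B + (i * h₅ B) * weightAbove F₂? (λ _ → + 1) B)

    h₅-rank : ∀ {B j} → rk* B ≡ j → h₅ B ≡ sgn (nullity* B) * sgn (suc j) * + nullity* B * m* B
    h₅-rank {B} rk*B≡j = cong (λ s → s * + nullity* B * m* B) (sgn-∣B∣+1 rk*B≡j)

    summand₅ : ∀ B → RankView B → xm1PowCoeff (nullity* B) 1 * (yFactor B 2 * m* B) ≡ rhs₅ B
    summand₅ B (rank0 refl) = trans (cong (λ ν → xm1PowCoeff ν 1 * (yFactor ⊥ 2 * m* ⊥)) nullity*-⊥)
      (sym (rhs₅-𝟙 ⊥ (𝟙-≤?-⊥ 2 (s≤s z≤n))))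

    summand₅ B (rank1 rk*B≡1) = rank1-term (2 ≤? ∣ B ∣)
      where
      rank1-term : Dec (2 ≤ ∣ B ∣) → xm1PowCoeff (nullity* B) 1 * (yFactor B 2 * m* B) ≡ rhs₅ B
      rank1-term (yes 2≤∣B∣) = trans
        (cong₂ (λ x y → x * (y * m* B)) (xm1PowCoeff-1 (nullity* B)) (yFactor-1-2 B rk*B≡1))
        (trans (identity (sgn (nullity* B)) (+ nullity* B) (+ r*) (sRes (closure B)) (m* B))
        (sym (trans (rhs₅-𝟙 B (𝟙-yes (2 ≤? ∣ B ∣) 2≤∣B∣))
                    (cong₂ _+_ (cong₂ (λ h w → + 1 * h * w) (h₄-rank1 rk*B≡1) (weightAbove-cyclic _ rk*B≡1 2≤∣B∣))
                               (cong₂ (λ h w → + 1 * h * w) (h₅-rank rk*B≡1) (weightAbove-F₂ rk*B≡1))))))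
        where
        identity : ∀ s ν c σ m → - s * ν * (- (c - + 1) * m)
                 ≡ + 1 * (s * - + 1 * (ν + + 1 - + 1) * m) * (σ - c + + 1) + + 1 * (s * (- + 1 * - + 1) * ν * m) * σ
        identity = solve-∀
      rank1-term (no 2≰∣B∣) = trans (cong (_* (yFactor B 2 * m* B)) (xm1PowCoeff-> (nullity*< {k = 1} rk*B≡1 2≰∣B∣)))
        (sym (rhs₅-𝟙 B (𝟙-no (2 ≤? ∣ B ∣) 2≰∣B∣)))

    summand₅ B (rank2 rk*B≡2) = trans
      (cong₂ (λ x y → x * (y * m* B)) (xm1PowCoeff-1 (nullity* B)) (yFactor-≡ B 2 rk*B≡2))
      (trans (identity (sgn (nullity* B)) (+ nullity* B) (m* B) (+ 1 * h₄ B))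
      (sym (trans (rhs₅-𝟙 B (𝟙-yes (2 ≤? ∣ B ∣) 2≤∣B∣))
                  (cong₂ _+_ (cong (+ 1 * h₄ B *_) (weightAbove-> CF₁? proj₂ _ (ℕ.≤-reflexive (sym rk*B≡2))))
                             (cong₂ (λ h w → + 1 * h * w) (h₅-rank rk*B≡2) (weightAbove-rank 2 _ rk*B≡2))))))
      where
      2≤∣B∣ : 2 ≤ ∣ B ∣
      2≤∣B∣ = subst (2 ≤_) (sym (∣B∣≡ rk*B≡2)) (ℕ.m≤n+m 2 (nullity* B))
      identity : ∀ s ν m a → - s * ν * (+ 1 * m) ≡ a * + 0 + + 1 * (s * - + 1 * ν * m) * + 1
      identity = solve-∀

    summand₅ B (rank≥3 2<rk*B) = trans
      (*-vanishʳ (xm1PowCoeff (nullity* B) 1) (cong (_* m* B) (yFactor-> B 2 2<rk*B)))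
      (sym (cong₂ _+_ (*-vanishʳ (𝟙 (2 ≤? ∣ B ∣) * h₄ B) (weightAbove-> CF₁? proj₂ _ (ℕ.<⇒≤ 2<rk*B)))
                      (*-vanishʳ (𝟙 (2 ≤? ∣ B ∣) * h₅ B) (weightAbove-> F₂? proj₂ _ 2<rk*B))))

    coeff-1-2 : coeff (multTutte 𝓜) (+ 1) (+ n - + r - + 2) ≡ RHS₅ (+ n - + r)
    coeff-1-2 = begin
      coeff (multTutte 𝓜) (+ 1) (+ n - + r - + 2)
        ≡⟨ coeff-at 1 2 ⟩
      ∑ (λ B → xm1PowCoeff (nullity* B) 1 * (yFactor B 2 * m* B))
        ≡⟨ ∑-cong (λ B → summand₅ B (rankView B)) ⟩
      ∑ rhs₅
        ≡⟨ ∑-+ (λ B → (𝟙 (2 ≤? ∣ B ∣) * h₄ B) * weightAbove CF₁? (w₁ (+ r*)) B)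
               (λ B → (𝟙 (2 ≤? ∣ B ∣) * h₅ B) * weightAbove F₂? (λ _ → + 1) B) ⟩
      ∑ (λ B → (𝟙 (2 ≤? ∣ B ∣) * h₄ B) * weightAbove CF₁? (w₁ (+ r*)) B)
        + ∑ (λ B → (𝟙 (2 ≤? ∣ B ∣) * h₅ B) * weightAbove F₂? (λ _ → + 1) B)
        ≡⟨ cong₂ _+_ (sym (sumWhere-⊆≥ CF₁? 2 (w₁ (+ r*)) h₄)) (sym (sumWhere-⊆≥₁ F₂? 2 h₅)) ⟩
      RHS₅ (+ r*)
        ≡⟨ cong RHS₅ (sym n-r≡r*) ⟩
      RHS₅ (+ n - + r) ∎
      where open ≡-Reasoning

    h₆ h₆′ : Subset n → ℤ
    h₆  A = sgn (∣ A ∣ ℕ.+ 1) * + ((∣ A ∣ ∸ 1) C 2) * m* A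
    h₆′ A = sgn ∣ A ∣ * + (nullity* A C 2) * m* A

    RHS₆ : ℤ → ℤ
    RHS₆ c = sumWhere (CyclicFlatOfRank rk* 1) CF₁?
              (λ F → w₁ c F * sumWhere (λ A → A ⊆ F × 3 ≤ ∣ A ∣) (λ A → (A ⊆? F) ×-dec (3 ≤? ∣ A ∣)) h₆)
          + sumWhere (FlatOfRank rk* 2) F₂?
              (λ F → sumWhere (λ A → A ⊆ F × 3 ≤ ∣ A ∣) (λ A → (A ⊆? F) ×-dec (3 ≤? ∣ A ∣)) h₆′)

    rhs₆ : Subset n → ℤ
    rhs₆ B = (𝟙 (3 ≤? ∣ B ∣) * h₆ B) * weightAbove CF₁? (w₁ (+ r*)) B
          + (𝟙 (3 ≤? ∣ B ∣) * h₆′ B) * weightAbove F₂? (λ _ → + 1) B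

    rhs₆-𝟙 : ∀ B {i} → 𝟙 (3 ≤? ∣ B ∣) ≡ i
          → rhs₆ B ≡ (i * h₆ B) * weightAbove CF₁? (w₁ (+ r*)) B + (i * h₆′ B) * weightAbove F₂? (λ _ → + 1) B
    rhs₆-𝟙 B = cong (λ i → (i * h₆ B) * weightAbove CF₁? (w₁ (+ r*)) B + (i * h₆′ B) * weightAbove F₂? (λ _ → + 1) B)

    h₆′-rank : ∀ {B j} → rk* B ≡ j → h₆′ B ≡ sgn (nullity* B) * sgn j * + (nullity* B C 2) * m* B
    h₆′-rank {B} rk*B≡j = cong (λ s → s * + (nullity* B C 2) * m* B) (sgn-∣B∣ rk*B≡j)

    summand₆ : ∀ B → RankView B → xm1PowCoeff (nullity* B) 2 * (yFactor B 2 * m* B) ≡ rhs₆ B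
    summand₆ B (rank0 refl) = trans (cong (λ ν → xm1PowCoeff ν 2 * (yFactor ⊥ 2 * m* ⊥)) nullity*-⊥)
                                (sym (rhs₆-𝟙 ⊥ (𝟙-≤?-⊥ 3 (s≤s z≤n))))

    summand₆ B (rank1 rk*B≡1) = rank1-term (3 ≤? ∣ B ∣)
      where
      rank1-term : Dec (3 ≤ ∣ B ∣) → xm1PowCoeff (nullity* B) 2 * (yFactor B 2 * m* B) ≡ rhs₆ B
      rank1-term (yes 3≤∣B∣) = trans
        (cong₂ (λ x y → x * (y * m* B)) (xm1PowCoeff-2 (nullity* B)) (yFactor-1-2 B rk*B≡1))
        (trans (identity (sgn (nullity* B)) (+ (nullity* B C 2)) (+ r*) (sRes (closure B)) (m* B))
        (sym (trans (rhs₆-𝟙 B (𝟙-yes (3 ≤? ∣ B ∣) 3≤∣B∣))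
                    (cong₂ _+_ (cong₂ (λ h w → + 1 * h * w) h₆-rank1
                                      (weightAbove-cyclic _ rk*B≡1 (ℕ.≤-trans (ℕ.n≤1+n 2) 3≤∣B∣)))
                               (cong₂ (λ h w → + 1 * h * w) (h₆′-rank rk*B≡1) (weightAbove-F₂ rk*B≡1))))))
        where
        h₆-rank1 : h₆ B ≡ sgn (nullity* B) * sgn 2 * + (nullity* B C 2) * m* B
        h₆-rank1 = cong₂ (λ s d → s * + (d C 2) * m* B) (sgn-∣B∣+1 rk*B≡1)
                         (trans (cong (_∸ 1) (∣B∣≡ rk*B≡1)) (ℕ.m+n∸n≡m (nullity* B) 1))
        identity : ∀ s C c σ m → s * C * (- (c - + 1) * m)
                 ≡ + 1 * (s * (- + 1 * - + 1) * C * m) * (σ - c + + 1) + + 1 * (s * - + 1 * C * m) * σ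
        identity = solve-∀
      rank1-term (no 3≰∣B∣) = trans (cong (_* (yFactor B 2 * m* B)) (xm1PowCoeff-> (nullity*< {k = 2} rk*B≡1 3≰∣B∣)))
        (sym (rhs₆-𝟙 B (𝟙-no (3 ≤? ∣ B ∣) 3≰∣B∣)))

    summand₆ B (rank2 rk*B≡2) = rank2-term (3 ≤? ∣ B ∣)
      where
      rank2-term : Dec (3 ≤ ∣ B ∣) → xm1PowCoeff (nullity* B) 2 * (yFactor B 2 * m* B) ≡ rhs₆ B
      rank2-term (yes 3≤∣B∣) = trans
        (cong₂ (λ x y → x * (y * m* B)) (xm1PowCoeff-2 (nullity* B)) (yFactor-≡ B 2 rk*B≡2))
        (trans (identity (sgn (nullity* B)) (+ (nullity* B C 2)) (m* B) (+ 1 * h₆ B))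
        (sym (trans (rhs₆-𝟙 B (𝟙-yes (3 ≤? ∣ B ∣) 3≤∣B∣))
                    (cong₂ _+_ (cong (+ 1 * h₆ B *_) (weightAbove-> CF₁? proj₂ _ (ℕ.≤-reflexive (sym rk*B≡2))))
                               (cong₂ (λ h w → + 1 * h * w) (h₆′-rank rk*B≡2) (weightAbove-rank 2 _ rk*B≡2))))))
        where
        identity : ∀ s C m a → s * C * (+ 1 * m) ≡ a * + 0 + + 1 * (s * (- + 1 * - + 1) * C * m) * + 1
        identity = solve-∀
      rank2-term (no 3≰∣B∣) = trans
        (cong (_* (yFactor B 2 * m* B)) (xm1PowCoeff-> (ℕ.m<n⇒m<1+n (nullity*< {k = 1} rk*B≡2 3≰∣B∣))))
        (sym (rhs₆-𝟙 B (𝟙-no (3 ≤? ∣ B ∣) 3≰∣B∣)))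

    summand₆ B (rank≥3 2<rk*B) = trans
      (*-vanishʳ (xm1PowCoeff (nullity* B) 2) (cong (_* m* B) (yFactor-> B 2 2<rk*B)))
      (sym (cong₂ _+_ (*-vanishʳ (𝟙 (3 ≤? ∣ B ∣) * h₆ B) (weightAbove-> CF₁? proj₂ _ (ℕ.<⇒≤ 2<rk*B)))
                      (*-vanishʳ (𝟙 (3 ≤? ∣ B ∣) * h₆′ B) (weightAbove-> F₂? proj₂ _ 2<rk*B))))

    coeff-2-2 : coeff (multTutte 𝓜) (+ 2) (+ n - + r - + 2) ≡ RHS₆ (+ n - + r)
    coeff-2-2 = begin
      coeff (multTutte 𝓜) (+ 2) (+ n - + r - + 2)
        ≡⟨ coeff-at 2 2 ⟩
      ∑ (λ B → xm1PowCoeff (nullity* B) 2 * (yFactor B 2 * m* B))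
        ≡⟨ ∑-cong (λ B → summand₆ B (rankView B)) ⟩
      ∑ rhs₆
        ≡⟨ ∑-+ (λ B → (𝟙 (3 ≤? ∣ B ∣) * h₆ B) * weightAbove CF₁? (w₁ (+ r*)) B)
               (λ B → (𝟙 (3 ≤? ∣ B ∣) * h₆′ B) * weightAbove F₂? (λ _ → + 1) B) ⟩
      ∑ (λ B → (𝟙 (3 ≤? ∣ B ∣) * h₆ B) * weightAbove CF₁? (w₁ (+ r*)) B)
        + ∑ (λ B → (𝟙 (3 ≤? ∣ B ∣) * h₆′ B) * weightAbove F₂? (λ _ → + 1) B)
        ≡⟨ cong₂ _+_ (sym (sumWhere-⊆≥ CF₁? 3 (w₁ (+ r*)) h₆)) (sym (sumWhere-⊆≥₁ F₂? 3 h₆′)) ⟩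
      RHS₆ (+ r*)
        ≡⟨ cong RHS₆ (sym n-r≡r*) ⟩
      RHS₆ (+ n - + r) ∎
      where open ≡-Reasoning

open import Defs
open import Data.Nat as ℕ using (ℕ; _∸_; _≤?_)
open import Data.Nat.Combinatorics using (_C_)
open import Data.Integer as ℤ using (ℤ; +_; _+_; _-_; _*_)
open import Data.Fin.Subset using (Subset; ⊤; ∁; ∣_∣; _⊆_)
open import Data.Fin.Subset.Properties using (_⊆?_)
open import Data.Product using (_×_; _,_)
open import Relation.Nullary.Decidable using (_×-dec_)
open import Relation.Binary.PropositionalEquality using (_≡_)
open Coefficients using (module TutteCoefficients)

theorem3p5 : ∀ {n : ℕ} (𝓜 : MultMatroid n) → HasNoColoops (MultMatroid.matroid 𝓜) →
  let open MultMatroid 𝓜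
      b : ℤ → ℤ → ℤ
      b = coeff (multTutte 𝓜)
      r : ℕ
      r = rk ⊤
      c : ℤ
      c = + n - + r
      rk* : Subset n → ℕ
      rk* = dualRk ⊤ rk
      m* : Subset n → ℤ
      m* A = + m (∁ A)
      mX : ℤ
      mX = + m ⊤
      sM : ℤ
      sM = + numSeriesClasses ⊤ rk
      sRes : Subset n → ℤ
      sRes T = + numSeriesClasses T rk
      sCon : Subset n → ℤ
      sCon T = + numSeriesClasses (∁ T) (contrRk rk T)
      ΣF1 : (Subset n → ℤ) → ℤ
      ΣF1 = sumWhere (FlatOfRank rk* 1) (flatOfRank? rk* 1)
      ΣF2 : (Subset n → ℤ) → ℤ
      ΣF2 = sumWhere (FlatOfRank rk* 2) (flatOfRank? rk* 2)
      ΣF'1 : (Subset n → ℤ) → ℤ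
      ΣF'1 = sumWhere (CyclicFlatOfRank rk* 1) (cyclicFlatOfRank? rk* 1)
      ΣSub : Subset n → (Subset n → ℤ) → ℤ
      ΣSub F = sumWhere (λ A → A ⊆ F) (λ A → A ⊆? F)
      ΣSub≥ : ℕ → Subset n → (Subset n → ℤ) → ℤ
      ΣSub≥ k F = sumWhere (λ A → A ⊆ F × k ℕ.≤ ∣ A ∣) (λ A → (A ⊆? F) ×-dec (k ≤? ∣ A ∣))
  in b (+ 0) c ≡ mX
   × b (+ 0) (c - + 1)
       ≡ (sM - c) * mX + ΣF1 (λ F → ΣSub F (λ A → sgn (∣ A ∣ ℕ.+ 1) * m* A))
   × b (+ 0) (c - + 2)
       ≡ (+ ((n ∸ r) C 2) - (c - + 1) * sM + ΣF2 (λ F → sCon (∁ F) - + 1)) * mX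
         + ΣF1 (λ F → (sRes (∁ F) - c + + 1) * ΣSub F (λ A → sgn (∣ A ∣ ℕ.+ 1) * m* A))
         + ΣF2 (λ F → ΣSub F (λ A → sgn ∣ A ∣ * m* A))
   × b (+ 1) (c - + 1)
       ≡ ΣF'1 (λ F → ΣSub≥ 2 F (λ A → sgn ∣ A ∣ * (+ ∣ A ∣ - + 1) * m* A))
   × b (+ 1) (c - + 2)
       ≡ ΣF'1 (λ F → (sRes (∁ F) - c + + 1)
                       * ΣSub≥ 2 F (λ A → sgn ∣ A ∣ * (+ ∣ A ∣ - + 1) * m* A))
         + ΣF2 (λ F → ΣSub≥ 2 F (λ A → sgn (∣ A ∣ ℕ.+ 1) * + (r ∸ rk (∁ A)) * m* A))
   × b (+ 2) (c - + 2)
       ≡ ΣF'1 (λ F → (sRes (∁ F) - c + + 1)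
                       * ΣSub≥ 3 F (λ A → sgn (∣ A ∣ ℕ.+ 1) * + ((∣ A ∣ ∸ 1) C 2) * m* A))
         + ΣF2 (λ F → ΣSub≥ 3 F (λ A → sgn ∣ A ∣ * + ((r ∸ rk (∁ A)) C 2) * m* A))
theorem3p5 𝓜 noColoops = coeff-0-0 , coeff-0-1 , coeff-0-2 , coeff-1-1 , coeff-1-2 , coeff-2-2
  where open TutteCoefficients 𝓜 noColoops
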